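{- Let $C(H,u)$ be a class of the partition $\Pi(2e,K)$, where $H$ is a hyperplane of $T$ and $u\in V'$ with $ru\notin H$. Then any two distinct vertices of $C(H,u)$ that are non-adjacent in $\overline{X(2e,K)}$ have $\frac{(q^{2e-2}-1)q^{2e-2}}{q-1}$ common neighbours in $\overline{X(2e,K)}$, and any two vertices of $C(H,u)$ that are adjacent in $\overline{X(2e,K)}$ have $\frac{(q^{2e-2}-1)q^{2e-2}}{q-1}-2$ common neighbours in $\overline{X(2e,K)}$.
   Context: Let $e\geq 2$ and let $K$ be a finite commutative ring with identity having precisely three ideals $\{0\}$, $J=\langle r\rangle$, $K$, with $K/J\cong\mathbb{F}_q$ ($q$ a prime power). Let $K^\times$ be the set of units, $V'$ the set of tuples in $K^{2e}$ with at least one entry in $K^\times$, for $a\in V'$ let $[a]=\{\lambda a:\lambda\in K^\times\}$, and $V=\{[a]:a\in V'\}$. For $a,b\in K^{2e}$ let $\langle a,b\rangle=\sum_{i=1}^e(a_ib_{e+i}-a_{e+i}b_i)$. The graph $X(2e,K)$ has vertex set $V$, $[a]\sim[b]$ iff $\langle a,b\rangle\in K\setminus\{0\}$; $\overline{X(2e,K)}$ is its complement. Let $T=J^{2e}$, a $2e$-dimensional vector space over $K/J$ with $(z+J)\cdot x=zx$; a hyperplane is a $(2e-1)$-dimensional subspace. For $u\in K^{2e}$, $ru\in T$ is the componentwise product. For a hyperplane $H$ and $u\in V'$ with $ru\notin H$, $C(H,u)=\{[u+h]:h\in H\}$; these sets form a partition of $V$, denoted $\Pi(2e,K)$. -}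

module Defs where

open import Level using (0ℓ)
open import Algebra.Bundles using (CommutativeRing)
open import Data.Nat as ℕ using (ℕ; _≤_)
open import Data.Nat.Primality using (Prime)
open import Data.Fin using (Fin; _↑ˡ_; _↑ʳ_) renaming (zero to fzero; suc to fsuc)
open import Data.List using (List; length)
open import Data.List.Relation.Unary.All using (All)
open import Data.List.Relation.Unary.Any using (Any)
open import Data.List.Relation.Unary.AllPairs using (AllPairs)
open import Data.Product using (Σ; ∃; _×_; _,_)
open import Data.Sum using (_⊎_)
open import Data.Unit using (⊤)
open import Relation.Nullary using (¬_)
open import Relation.Binary.PropositionalEquality using (_≡_)

IsPrimePower : ℕ → Set
IsPrimePower q = ∃ λ p → ∃ λ k → Prime p × 1 ≤ k × q ≡ p ℕ.^ k

module RingDefs (R : CommutativeRing 0ℓ 0ℓ) where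
  open CommutativeRing R renaming (Carrier to K) hiding (zero)

  Σ' : (n : ℕ) → (Fin n → K) → K
  Σ' ℕ.zero    f = 0#
  Σ' (ℕ.suc n) f = f fzero + Σ' n (λ i → f (fsuc i))

  IsUnit : K → Set
  IsUnit x = ∃ λ y → x * y ≈ 1#

  record IsIdeal (I : K → Set) : Set where
    field
      resp  : ∀ {x y} → x ≈ y → I x → I y
      zero∈ : I 0#
      +-cl  : ∀ {x y} → I x → I y → I (x + y)
      *-cl  : ∀ k {x} → I x → I (k * x)

  _≐_ : (K → Set) → (K → Set) → Set
  I ≐ I' = ∀ x → (I x → I' x) × (I' x → I x)

  ZeroIdeal : K → Set
  ZeroIdeal x = x ≈ 0#

  WholeIdeal : K → Set
  WholeIdeal x = ⊤

  Principal : K → K → Set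
  Principal r x = ∃ λ k → x ≈ k * r

  IsFinite : Set
  IsFinite = ∃ λ (xs : List K) → ∀ x → Any (x ≈_) xs

  ExactlyThreeIdeals : K → Set₁
  ExactlyThreeIdeals r =
    (¬ (r ≈ 0#)) × (¬ Principal r 1#) ×
    (∀ (I : K → Set) → IsIdeal I →
       (I ≐ ZeroIdeal) ⊎ (I ≐ Principal r) ⊎ (I ≐ WholeIdeal))

  -- |K / J| = q : a list of q pairwise incongruent representatives
  -- of all cosets of J
  QuotCard : (J : K → Set) → ℕ → Set
  QuotCard J q = ∃ λ (ys : List K) → length ys ≡ q ×
    AllPairs (λ y y' → ¬ J (y - y')) ys × (∀ x → Any (λ y → J (x - y)) ys)

  -- Vectors in K^{2e}, indexed by Fin (e + e):
  -- index i (i < e) is  i ↑ˡ e,  index e+i is  e ↑ʳ i.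
  module Vecs (e : ℕ) where
    Vec2e : Set
    Vec2e = Fin (e ℕ.+ e) → K

    _≈v_ : Vec2e → Vec2e → Set
    a ≈v b = ∀ i → a i ≈ b i

    _+v_ : Vec2e → Vec2e → Vec2e
    (a +v b) i = a i + b i

    _·v_ : K → Vec2e → Vec2e
    (z ·v a) i = z * a i

    0v : Vec2e
    0v i = 0#

    InV' : Vec2e → Set
    InV' a = ∃ λ i → IsUnit (a i)

    -- [a] = [b]  iff  b = λ a for some unit λ
    _∼_ : Vec2e → Vec2e → Set
    a ∼ b = ∃ λ l → IsUnit l × b ≈v (l ·v a)

    ⟪_,_⟫ : Vec2e → Vec2e → K
    ⟪ a , b ⟫ = Σ' e (λ i → a ((i ↑ˡ e)) * b ((e ↑ʳ i))
                          - a ((e ↑ʳ i)) * b ((i ↑ˡ e)))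

    AdjX : Vec2e → Vec2e → Set
    AdjX a b = ¬ (⟪ a , b ⟫ ≈ 0#)

    AdjXbar : Vec2e → Vec2e → Set
    AdjXbar a b = ¬ (a ∼ b) × ¬ AdjX a b

    -- a set of vertices (given by representatives in V', predicate P
    -- assumed to be closed under ∼) has exactly N elements:
    -- there is a list of N pairwise non-associate representatives in P
    -- meeting every class contained in P.
    VertexSetCard : (Vec2e → Set) → ℕ → Set
    VertexSetCard P N = ∃ λ (xs : List Vec2e) → length xs ≡ N ×
      All (λ x → InV' x × P x) xs ×
      AllPairs (λ x y → ¬ (x ∼ y)) xs ×
      (∀ x → InV' x → P x → Any (x ∼_) xs)

    CommonNbrs : Vec2e → Vec2e → Vec2e → Set
    CommonNbrs a b c = AdjXbar a c × AdjXbar b c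

    -- T = J^{2e} as a vector space over K/J, hyperplanes
    module Space (J : K → Set) where
      InT : Vec2e → Set
      InT x = ∀ i → J (x i)

      lin : (m : ℕ) → (Fin m → K) → (Fin m → Vec2e) → Vec2e
      lin m c b i = Σ' m (λ j → c j * b j i)

      -- H is a (2e-1)-dimensional subspace of T over K/J: it has a basis
      -- of 2e-1 vectors of T (scalars z ∈ K acting as z + J)
      IsHyperplane : (Vec2e → Set) → Set
      IsHyperplane H = ∃ λ (b : Fin (e ℕ.+ e ℕ.∸ 1) → Vec2e) →
        (∀ j → InT (b j)) ×
        (∀ c → lin _ c b ≈v 0v → ∀ j → J (c j)) ×
        (∀ h → (H h → ∃ λ c → h ≈v lin _ c b) ×
               ((∃ λ c → h ≈v lin _ c b) → H h))

      r· : K → Vec2e → Vec2e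
      r· r u i = r * u i

      -- [x] ∈ C(H,u) = { [u+h] : h ∈ H }
      InClass : (Vec2e → Set) → Vec2e → Vec2e → Set
      InClass H u x = ∃ λ h → H h × ((u +v h) ∼ x)

-- Write a ∼ a′ = u + h and b ∼ b′ = u + h′ with h, h′ ∈ H ⊆ J^{2e}, so that b′ = a′ + r w.
-- Since r x = 0 exactly when x ∈ J, a vector c is orthogonal to both a and b iff
-- ⟨a′,c⟩ = 0 and ⟨w,c⟩ ∈ J. As r u ∉ H and [a] ≠ [b], w is independent of a′ modulo J,
-- which yields x₁, y₁ with ⟨a′,x₁⟩ = 1, ⟨a′,y₁⟩ = 0 and ⟨w,y₁⟩ = 1; translating along
-- them shows that all fibres of c ↦ (⟨a′,c⟩, ⟨w,c⟩ mod J) have the same size. So the two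
-- conditions cut the q^{4e} vectors of K^{2e} down to q^{4e-3}, of which q^{2e-1} lie in
-- J^{2e}; the others fall into classes of q² - q associates, which gives
-- (q^{2e-2} - 1) q^{2e-2} / (q - 1) points, [a] and [b] included when ⟨a,b⟩ = 0.

module Submission where

open import Level using (0ℓ)
open import Algebra.Bundles using (CommutativeRing)
open import Data.Nat as ℕ using (ℕ; zero; suc)
open import Data.Integer as ℤ using (ℤ; +_; -[1+_])
open import Data.Fin as Fin using (Fin; _↑ˡ_; _↑ʳ_; splitAt)
open import Data.Maybe using (Maybe; just; nothing)
open import Data.Product using (∃; _×_; _,_; proj₁; proj₂)
open import Data.Sum using (_⊎_; inj₁; inj₂; [_,_]′)
open import Data.Unit using (⊤; tt)
open import Data.Empty using (⊥-elim)
open import Function using (id; _∘_)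
open import Relation.Nullary using (¬_; Dec; yes; no; contradiction)
open import Relation.Nullary.Decidable using (decidable-stable)
open import Relation.Binary.Bundles using (Setoid; DecSetoid)
open import Relation.Binary.PropositionalEquality as ≡ using (_≡_; _≢_)

open import Defs

module IntegerCoefficientSolver (R : CommutativeRing 0ℓ 0ℓ) where
  open CommutativeRing R
  -- This multiple satisfies 1 · x = x definitionally, so that fromℤ (+ 1) is 1# on the nose.
  open import Algebra.Properties.Semiring.Mult.TCOptimised semiring
    using (1+×; ×-homo-+; ×1-homo-*) renaming (_×_ to _·_)
  open import Algebra.Properties.Ring ring using (-‿distribˡ-*; -‿distribʳ-*)
  open import Algebra.Properties.AbelianGroup +-abelianGroup using (⁻¹-∙-comm)
  open import Algebra.Properties.Group +-group using (ε⁻¹≈ε; ⁻¹-involutive)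
  open import Algebra.Solver.Ring.AlmostCommutativeRing
    using (AlmostCommutativeRing; fromCommutativeRing; _-Raw-AlmostCommutative⟶_)
  import Data.Integer.Properties as ℤ
  import Data.Nat.Properties as ℕ
  import Data.Sign as Sign
  open import Relation.Binary.Reasoning.Setoid setoid

  fromℤ : ℤ → Carrier
  fromℤ (+ n)    = n · 1#
  fromℤ -[1+ n ] = - (suc n · 1#)

  fromℤ-neg : ∀ i → fromℤ (ℤ.- i) ≈ - fromℤ i
  fromℤ-neg -[1+ n ]    = sym (⁻¹-involutive _)
  fromℤ-neg (+ zero)    = sym ε⁻¹≈ε
  fromℤ-neg (+ (suc n)) = refl

  fromℤ-⊖ : ∀ m n → fromℤ (m ℤ.⊖ n) ≈ m · 1# - n · 1#
  fromℤ-⊖ m       zero    = begin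
    fromℤ (m ℤ.⊖ 0) ≡⟨ ≡.cong fromℤ (ℤ.⊖-≥ {m} ℕ.z≤n) ⟩
    m · 1#          ≈⟨ sym (+-identityʳ _) ⟩
    m · 1# + 0#     ≈⟨ +-congˡ (sym ε⁻¹≈ε) ⟩
    m · 1# - 0#     ∎
  fromℤ-⊖ zero    (suc n) = sym (+-identityˡ _)
  fromℤ-⊖ (suc m) (suc n) = begin
    fromℤ (suc m ℤ.⊖ suc n)             ≡⟨ ≡.cong fromℤ (ℤ.[1+m]⊖[1+n]≡m⊖n m n) ⟩
    fromℤ (m ℤ.⊖ n)                     ≈⟨ fromℤ-⊖ m n ⟩
    m · 1# - n · 1#                     ≈⟨ sym (cancel 1# (m · 1#) (n · 1#)) ⟩
    (1# + m · 1#) - (1# + n · 1#)       ≈⟨ sym (+-cong (1+× m 1#) (-‿cong (1+× n 1#))) ⟩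
    suc m · 1# - suc n · 1#             ∎
    where
    cancel : ∀ x y z → (x + y) - (x + z) ≈ y - z
    cancel x y z = begin
      (x + y) - (x + z)     ≈⟨ +-congˡ (sym (⁻¹-∙-comm x z)) ⟩
      (x + y) + (- x - z)   ≈⟨ +-assoc x y _ ⟩
      x + (y + (- x - z))   ≈⟨ +-congˡ (trans (sym (+-assoc y (- x) _)) (+-congʳ (+-comm y (- x)))) ⟩
      x + ((- x + y) - z)   ≈⟨ +-congˡ (+-assoc (- x) y _) ⟩
      x + (- x + (y - z))   ≈⟨ sym (+-assoc x (- x) _) ⟩
      (x - x) + (y - z)     ≈⟨ +-congʳ (-‿inverseʳ x) ⟩
      0# + (y - z)          ≈⟨ +-identityˡ _ ⟩
      y - z                 ∎

  fromℤ-+ : ∀ i j → fromℤ (i ℤ.+ j) ≈ fromℤ i + fromℤ j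
  fromℤ-+ -[1+ m ] -[1+ n ] = begin
    - (suc (suc (m ℕ.+ n)) · 1#)      ≡⟨ ≡.cong (λ k → - (suc k · 1#)) (≡.sym (ℕ.+-suc m n)) ⟩
    - ((suc m ℕ.+ suc n) · 1#)        ≈⟨ -‿cong (×-homo-+ 1# (suc m) (suc n)) ⟩
    - (suc m · 1# + suc n · 1#)       ≈⟨ sym (⁻¹-∙-comm _ _) ⟩
    - (suc m · 1#) - (suc n · 1#)     ∎
  fromℤ-+ -[1+ m ] (+ n)    = trans (fromℤ-⊖ n (suc m)) (+-comm _ _)
  fromℤ-+ (+ m)    -[1+ n ] = fromℤ-⊖ m (suc n)
  fromℤ-+ (+ m)    (+ n)    = ×-homo-+ 1# m n

  fromℤ-[+◃] : ∀ n → fromℤ (Sign.+ ℤ.◃ n) ≈ n · 1#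
  fromℤ-[+◃] n = reflexive (≡.cong fromℤ (ℤ.+◃n≡+n n))

  fromℤ-[-◃] : ∀ n → fromℤ (Sign.- ℤ.◃ n) ≈ - (n · 1#)
  fromℤ-[-◃] n = trans (reflexive (≡.cong fromℤ (ℤ.-◃n≡-n n))) (fromℤ-neg (+ n))

  fromℤ-* : ∀ i j → fromℤ (i ℤ.* j) ≈ fromℤ i * fromℤ j
  fromℤ-* -[1+ m ] -[1+ n ] = begin
    fromℤ (Sign.+ ℤ.◃ (suc m ℕ.* suc n)) ≈⟨ fromℤ-[+◃] (suc m ℕ.* suc n) ⟩
    (suc m ℕ.* suc n) · 1#               ≈⟨ ×1-homo-* (suc m) (suc n) ⟩
    suc m · 1# * suc n · 1#              ≈⟨ sym (⁻¹-involutive _) ⟩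
    - - (suc m · 1# * suc n · 1#)        ≈⟨ -‿cong (-‿distribˡ-* _ _) ⟩
    - (- (suc m · 1#) * suc n · 1#)      ≈⟨ -‿distribʳ-* _ _ ⟩
    - (suc m · 1#) * - (suc n · 1#)      ∎
  fromℤ-* -[1+ m ] (+ n)    = begin
    fromℤ (Sign.- ℤ.◃ (suc m ℕ.* n))     ≈⟨ fromℤ-[-◃] (suc m ℕ.* n) ⟩
    - ((suc m ℕ.* n) · 1#)               ≈⟨ -‿cong (×1-homo-* (suc m) n) ⟩
    - (suc m · 1# * n · 1#)              ≈⟨ -‿distribˡ-* _ _ ⟩
    - (suc m · 1#) * n · 1#              ∎
  fromℤ-* (+ m)    -[1+ n ] = begin
    fromℤ (Sign.- ℤ.◃ (m ℕ.* suc n))     ≈⟨ fromℤ-[-◃] (m ℕ.* suc n) ⟩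
    - ((m ℕ.* suc n) · 1#)               ≈⟨ -‿cong (×1-homo-* m (suc n)) ⟩
    - (m · 1# * suc n · 1#)              ≈⟨ -‿distribʳ-* _ _ ⟩
    m · 1# * - (suc n · 1#)              ∎
  fromℤ-* (+ m)    (+ n)    = trans (fromℤ-[+◃] (m ℕ.* n)) (×1-homo-* m n)

  almostCommutativeRing : AlmostCommutativeRing 0ℓ 0ℓ
  almostCommutativeRing = fromCommutativeRing R

  fromℤ-morphism : ℤ.+-*-rawRing -Raw-AlmostCommutative⟶ almostCommutativeRing
  fromℤ-morphism = record
    { ⟦_⟧ = fromℤ ; +-homo = fromℤ-+ ; *-homo = fromℤ-* ; -‿homo = fromℤ-neg ; 0-homo = refl ; 1-homo = refl }

  ≟-coefficients : ∀ i j → Maybe (fromℤ i ≈ fromℤ j)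
  ≟-coefficients i j with i ℤ.≟ j
  ... | yes ≡.refl = just refl
  ... | no _       = nothing

  open import Algebra.Solver.Ring ℤ.+-*-rawRing almostCommutativeRing fromℤ-morphism ≟-coefficients public
    using (solve; _:=_; _:+_; _:*_; _:-_; :-_; con)

module Counting where
  import Relation.Binary.Definitions as Binary
  open import Relation.Unary using (Pred; Decidable; _⊆_; _∪_)
  open import Function.Definitions using (Congruent; Injective)
  open import Data.Nat using (_≤_; _+_; _*_; _^_; z≤n; s≤s)
  open import Data.Nat.Properties using (≤-antisym; module ≤-Reasoning)
  open import Data.List using (List; []; _∷_; length; _++_; map; filter; deduplicate)
  open import Data.List.Properties using (length-removeAt′; length-++; length-map)
  open import Data.List.Relation.Unary.All as All using (All; []; _∷_)
  open import Data.List.Relation.Unary.AllPairs using ([]; _∷_)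
  import Data.List.Relation.Unary.All.Properties as All
  open import Data.List.Relation.Unary.Any using (here; there; index)
  import Data.List.Membership.Setoid as Membership
  import Data.List.Membership.Setoid.Properties as Membershipₚ
  import Data.List.Relation.Unary.Unique.Setoid as Unique
  import Data.List.Relation.Unary.Unique.Setoid.Properties as Uniqueₚ
  import Data.List.Relation.Unary.Unique.DecSetoid.Properties as DecUniqueₚ
  import Data.Vec.Functional as Vector
  open import Data.Vec.Functional.Relation.Binary.Equality.Setoid using (≋-setoid)

  module _ (S : Setoid 0ℓ 0ℓ) where
    open Setoid S renaming (Carrier to A)
    open Membership S using (_∈_; _─_)
    open Unique S using (Unique)

    record HasSize (P : Pred A 0ℓ) (n : ℕ) : Set where
      field
        elements : List A
        length≡  : length elements ≡ n
        all      : All P elements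
        unique   : Unique elements
        complete : P ⊆ (_∈ elements)

    open HasSize

    private
      ∈-─⁺ : ∀ {x y ys} (x∈ys : x ∈ ys) → y ∈ ys → ¬ x ≈ y → y ∈ ys ─ x∈ys
      ∈-─⁺ (here x≈z) (here y≈z) x≉y = ⊥-elim (x≉y (trans x≈z (sym y≈z)))
      ∈-─⁺ (here _)   (there y∈) _   = y∈
      ∈-─⁺ (there _)  (here y≈z) _   = here y≈z
      ∈-─⁺ (there x∈) (there y∈) x≉y = there (∈-─⁺ x∈ y∈ x≉y)

    length-mono : ∀ {xs ys} → Unique xs → All (_∈ ys) xs → length xs ≤ length ys
    length-mono {[]}     _            _                = z≤n
    length-mono {x ∷ xs} {ys} (x≉xs ∷ xs!) (x∈ys ∷ xs⊆ys) = begin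
      suc (length xs)          ≤⟨ s≤s (length-mono xs! xs⊆ys─x) ⟩
      suc (length (ys ─ x∈ys)) ≡⟨ ≡.sym (length-removeAt′ ys (index x∈ys)) ⟩
      length ys                ∎
      where
      open ≤-Reasoning
      xs⊆ys─x = All.zipWith (λ (x≉y , y∈ys) → ∈-─⁺ x∈ys y∈ys x≉y) (x≉xs , xs⊆ys)

    HasSize-unique : ∀ {P m n} → HasSize P m → HasSize P n → m ≡ n
    HasSize-unique X Y = ≤-antisym (bound X Y) (bound Y X)
      where
      bound : ∀ {P m n} → HasSize P m → HasSize P n → m ≤ n
      bound X Y = ≡.subst₂ _≤_ (length≡ X) (length≡ Y) (length-mono (unique X) (All.map (complete Y) (all X)))

    HasSize-resp : ∀ {P Q n} → P ⊆ Q → Q ⊆ P → HasSize P n → HasSize Q n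
    HasSize-resp P⊆Q Q⊆P X = record
      { elements = elements X ; length≡ = length≡ X ; all = All.map P⊆Q (all X) ; unique = unique X
      ; complete = λ q → complete X (Q⊆P q) }

    HasSize-∅ : ∀ {P} → (∀ {x} → ¬ P x) → HasSize P 0
    HasSize-∅ ¬P = record
      { elements = [] ; length≡ = ≡.refl ; all = [] ; unique = [] ; complete = λ p → ⊥-elim (¬P p) }

    HasSize-singleton : ∀ {P} a → P a → (∀ {x} → P x → x ≈ a) → HasSize P 1
    HasSize-singleton a pa P⇒≈a = record
      { elements = a ∷ [] ; length≡ = ≡.refl ; all = pa ∷ [] ; unique = [] ∷ [] ; complete = λ p → here (P⇒≈a p) }

    HasSize-nonZero : ∀ {P n x} → P x → HasSize P n → ℕ.NonZero n
    HasSize-nonZero Px X = nonEmpty (length≡ X) (complete X Px)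
      where
      nonEmpty : ∀ {xs n x} → length xs ≡ n → x ∈ xs → ℕ.NonZero n
      nonEmpty {_ ∷ _} ≡.refl _ = _

    HasSize-∪ : ∀ {P Q m n} → HasSize P m → HasSize Q n → (∀ {x y} → P x → Q y → ¬ x ≈ y) →
                HasSize (P ∪ Q) (m + n)
    HasSize-∪ X Y P≉Q = record
      { elements = elements X ++ elements Y
      ; length≡  = ≡.trans (length-++ (elements X)) (≡.cong₂ _+_ (length≡ X) (length≡ Y))
      ; all      = All.++⁺ (All.map inj₁ (all X)) (All.map inj₂ (all Y))
      ; unique   = Uniqueₚ.++⁺ S (unique X) (unique Y) disjoint
      ; complete = λ { (inj₁ p) → Membershipₚ.∈-++⁺ˡ S (complete X p)
                     ; (inj₂ q) → Membershipₚ.∈-++⁺ʳ S (elements X) (complete Y q) } }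
      where
      disjoint : ∀ {v} → ¬ (v ∈ elements X × v ∈ elements Y)
      disjoint (v∈X , v∈Y) with All.lookupAny (all X) v∈X | All.lookupAny (all Y) v∈Y
      ... | p , v≈x | q , v≈y = P≉Q p q (trans (sym v≈x) v≈y)

    HasSize-filter : ∀ {P Q n} → Decidable Q → (∀ {x y} → x ≈ y → Q x → Q y) → Q ⊆ P →
                     HasSize P n → ∃ (HasSize Q)
    HasSize-filter Q? Q-resp Q⊆P X = _ , record
      { elements = filter Q? (elements X)
      ; length≡  = ≡.refl
      ; all      = All.all-filter Q? (elements X)
      ; unique   = Uniqueₚ.filter⁺ S Q? (unique X)
      ; complete = λ q → Membershipₚ.∈-filter⁺ S Q? Q-resp (complete X (Q⊆P q)) q }

  open HasSize

  module _ (S₁ S₂ : Setoid 0ℓ 0ℓ) where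
    open Setoid S₁ using () renaming (Carrier to A; _≈_ to _≈₁_)
    open Setoid S₂ using () renaming (Carrier to B; _≈_ to _≈₂_; sym to sym₂; trans to trans₂)
    open Membership S₂ using () renaming (_∈_ to _∈₂_)

    HasSize-bijection : ∀ {P Q n} (f : A → B) → Congruent _≈₁_ _≈₂_ f → Injective _≈₁_ _≈₂_ f →
                        (∀ {x} → P x → Q (f x)) → (∀ {y} → Q y → ∃ λ x → P x × f x ≈₂ y) →
                        HasSize S₁ P n → HasSize S₂ Q n
    HasSize-bijection f f-cong f-inj P⇒Qf Q⇒fP X = record
      { elements = map f (elements X)
      ; length≡  = ≡.trans (length-map f (elements X)) (length≡ X)
      ; all      = All.map⁺ (All.map P⇒Qf (all X))
      ; unique   = Uniqueₚ.map⁺ S₁ S₂ f-inj (unique X)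
      ; complete = λ q → let x , p , fx≈y = Q⇒fP q in
                         Membershipₚ.∈-resp-≈ S₂ fx≈y (Membershipₚ.∈-map⁺ S₁ S₂ f-cong (complete X p)) }

    HasSize-image : ∀ {P Q n} → Binary.Decidable _≈₂_ → (f : A → B) → Congruent _≈₁_ _≈₂_ f →
                    (∀ {x} → P x → Q (f x)) → (∀ {y} → Q y → ∃ λ x → P x × f x ≈₂ y) →
                    HasSize S₁ P n → ∃ (HasSize S₂ Q)
    HasSize-image _≟₂_ f f-cong P⇒Qf Q⇒fP X = _ , record
      { elements = deduplicate _≟₂_ (map f (elements X))
      ; length≡  = ≡.refl
      ; all      = All.deduplicate⁺ _≟₂_ (All.map⁺ (All.map P⇒Qf (all X)))
      ; unique   = DecUniqueₚ.deduplicate-! decSetoid (map f (elements X))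
      ; complete = λ q → let x , p , fx≈y = Q⇒fP q in
                         Membershipₚ.∈-deduplicate⁺ S₂ _≟₂_ (λ z≈y x≈y → trans₂ x≈y (sym₂ z≈y))
                           (Membershipₚ.∈-resp-≈ S₂ fx≈y (Membershipₚ.∈-map⁺ S₁ S₂ f-cong (complete X p))) }
      where
      decSetoid : DecSetoid 0ℓ 0ℓ
      decSetoid = record { isDecEquivalence = record { isEquivalence = Setoid.isEquivalence S₂ ; _≟_ = _≟₂_ } }

    HasSize-fibres : ∀ {P Q k n} (f : A → B) → Congruent _≈₁_ _≈₂_ f → (∀ {x} → P x → Q (f x)) →
                     HasSize S₂ Q k → (∀ {y} → Q y → HasSize S₁ (λ x → P x × f x ≈₂ y) n) →
                     HasSize S₁ P (k * n)
    HasSize-fibres {P} {Q} {n = n} f f-cong P⇒Qf Y fibre =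
      ≡.subst (HasSize S₁ P) (≡.cong (_* n) (length≡ Y))
        (HasSize-resp S₁ proj₁ (λ p → p , complete Y (P⇒Qf p)) (over (unique Y) (all Y)))
      where
      over : ∀ {ys} → Unique.Unique S₂ ys → All Q ys → HasSize S₁ (λ x → P x × f x ∈₂ ys) (length ys * n)
      over []           []       = HasSize-∅ S₁ λ ()
      over {y ∷ ys} (y∉ys ∷ ys!) (q ∷ qs) = HasSize-resp S₁
        (λ { (inj₁ (p , fx≈y)) → p , here fx≈y ; (inj₂ (p , fx∈ys)) → p , there fx∈ys })
        (λ { (p , here fx≈y) → inj₁ (p , fx≈y) ; (p , there fx∈ys) → inj₂ (p , fx∈ys) })
        (HasSize-∪ S₁ (fibre q) (over ys! qs) λ (_ , fx≈y) (_ , fx′∈ys) x≈x′ →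
          Membershipₚ.All[≉]⇒∉ S₂ y∉ys
            (Membershipₚ.∈-resp-≈ S₂ (trans₂ (sym₂ (f-cong x≈x′)) fx≈y) fx′∈ys))

  HasSize-Π : ∀ (S : Setoid 0ℓ 0ℓ) {P k} n → HasSize S P k →
              HasSize (≋-setoid S n) (λ g → ∀ i → P (g i)) (k ^ n)
  HasSize-Π S zero    X = HasSize-singleton (≋-setoid S zero) (λ ()) (λ ()) (λ _ ())
  HasSize-Π S {P} {k} (suc n) X =
    HasSize-fibres (≋-setoid S (suc n)) S Vector.head (λ g≋h → g≋h Fin.zero) (λ p → p Fin.zero) X fibre
    where
    open Setoid S using (_≈_; refl; sym)
    fibre : ∀ {y} → P y → HasSize (≋-setoid S (suc n)) (λ g → (∀ i → P (g i)) × g Fin.zero ≈ y) (k ^ n)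
    fibre {y} py = HasSize-bijection (≋-setoid S n) (≋-setoid S (suc n)) (y Vector.∷_)
      (λ { g≋h Fin.zero → refl ; g≋h (Fin.suc i) → g≋h i })
      (λ y∷g≋y∷h i → y∷g≋y∷h (Fin.suc i))
      (λ p → (λ { Fin.zero → py ; (Fin.suc i) → p i }) , refl)
      (λ { {g} (p , g₀≈y) → Vector.tail g , (λ i → p (Fin.suc i)) , λ { Fin.zero → sym g₀≈y ; (Fin.suc i) → refl } })
      (HasSize-Π S n X)

module Arithmetic where
  open import Data.Nat
  open import Data.Nat.Properties
  open import Data.Nat.Solver using (module +-*-Solver)
  open +-*-Solver using (solve; _:=_; _:+_; _:*_; con)
  open ≡.≡-Reasoning

  ^-distribʳ-* : ∀ m n k → (m * n) ^ k ≡ m ^ k * n ^ k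
  ^-distribʳ-* m n zero    = ≡.refl
  ^-distribʳ-* m n (suc k) = begin
    (m * n) * (m * n) ^ k     ≡⟨ ≡.cong (m * n *_) (^-distribʳ-* m n k) ⟩
    (m * n) * (m ^ k * n ^ k) ≡⟨ solve 4 (λ m n x y → (m :* n) :* (x :* y) := (m :* x) :* (n :* y))
                                         ≡.refl m n (m ^ k) (n ^ k) ⟩
    (m * m ^ k) * (n * n ^ k) ∎

  class-count : ∀ q m {n₀ n₁ n₂ n₃ N k} .{{_ : NonZero q}} →
                k + q ≡ q * q → (q * q) * n₀ ≡ (q * q) ^ (2 + m) → q * n₁ ≡ n₀ →
                q * n₂ ≡ q ^ (2 + m) → n₃ + n₂ ≡ n₁ → N * k ≡ n₃ →
                N * (q ∸ 1) ≡ (q ^ m ∸ 1) * q ^ m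
  class-count q@(suc p) m {n₀} {n₁} {n₂} {n₃} {N} {k} k+q≡q² q²n₀≡ qn₁≡n₀ qn₂≡ n₃+n₂≡n₁ Nk≡n₃ = begin
    N * p             ≡⟨ m+n∸n≡m (N * p) Q ⟨
    N * p + Q ∸ Q     ≡⟨ ≡.cong (_∸ Q) Np+Q≡Q² ⟩
    Q * Q ∸ Q         ≡⟨ ≡.cong (Q * Q ∸_) (*-identityˡ Q) ⟨
    Q * Q ∸ 1 * Q     ≡⟨ *-distribʳ-∸ Q Q 1 ⟨
    (Q ∸ 1) * Q       ∎
    where
    Q = q ^ m
    k≡qp : k ≡ q * p
    k≡qp = +-cancelʳ-≡ q k (q * p) (≡.trans k+q≡q²
      (solve 1 (λ p → (con 1 :+ p) :* (con 1 :+ p) := (con 1 :+ p) :* p :+ (con 1 :+ p)) ≡.refl p))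
    n₀≡ : n₀ ≡ (q * q) * (Q * Q)
    n₀≡ = *-cancelˡ-≡ n₀ _ (q * q) {{m*n≢0 q q}}
      (≡.trans q²n₀≡ (≡.cong (λ x → (q * q) * ((q * q) * x)) (^-distribʳ-* q q m)))
    Np+Q≡Q² : N * p + Q ≡ Q * Q
    Np+Q≡Q² = *-cancelˡ-≡ _ _ q (*-cancelˡ-≡ _ _ q (begin
      q * (q * (N * p + Q))           ≡⟨ solve 4 (λ q N p Q → q :* (q :* (N :* p :+ Q))
                                                         := q :* (N :* (q :* p)) :+ q :* (q :* Q)) ≡.refl q N p Q ⟩
      q * (N * (q * p)) + q * (q * Q) ≡⟨ ≡.cong₂ (λ x y → q * (N * x) + y) k≡qp qn₂≡ ⟨
      q * (N * k) + q * n₂            ≡⟨ ≡.cong (λ x → q * x + q * n₂) Nk≡n₃ ⟩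
      q * n₃ + q * n₂                 ≡⟨ *-distribˡ-+ q n₃ n₂ ⟨
      q * (n₃ + n₂)                   ≡⟨ ≡.cong (q *_) n₃+n₂≡n₁ ⟩
      q * n₁                          ≡⟨ ≡.trans qn₁≡n₀ n₀≡ ⟩
      (q * q) * (Q * Q)               ≡⟨ *-assoc q q (Q * Q) ⟩
      q * (q * (Q * Q))               ∎))

module UnitsAndIdeals (R : CommutativeRing 0ℓ 0ℓ) where
  open CommutativeRing R renaming (Carrier to K)
  open import Algebra.Properties.Ring ring using (-1*x≈-x)
  open RingDefs R
  open IntegerCoefficientSolver R
  open import Relation.Binary.Reasoning.Setoid setoid

  IsUnit-resp : ∀ {x y} → x ≈ y → IsUnit x → IsUnit y
  IsUnit-resp x≈y (x⁻¹ , xx⁻¹≈1) = x⁻¹ , trans (*-congʳ (sym x≈y)) xx⁻¹≈1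

  IsUnit-1# : IsUnit 1#
  IsUnit-1# = 1# , *-identityʳ 1#

  IsUnit-* : ∀ {x y} → IsUnit x → IsUnit y → IsUnit (x * y)
  IsUnit-* {x} {y} (x⁻¹ , xx⁻¹≈1) (y⁻¹ , yy⁻¹≈1) = y⁻¹ * x⁻¹ , (begin
    (x * y) * (y⁻¹ * x⁻¹) ≈⟨ solve 4 (λ x y y⁻¹ x⁻¹ → (x :* y) :* (y⁻¹ :* x⁻¹) := (x :* x⁻¹) :* (y :* y⁻¹))
                                     refl x y y⁻¹ x⁻¹ ⟩
    (x * x⁻¹) * (y * y⁻¹) ≈⟨ *-cong xx⁻¹≈1 yy⁻¹≈1 ⟩
    1# * 1#               ≈⟨ *-identityʳ 1# ⟩
    1#                    ∎)

  IsUnit-neg : ∀ {x} → IsUnit x → IsUnit (- x)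
  IsUnit-neg {x} (x⁻¹ , xx⁻¹≈1) = - x⁻¹ , trans (solve 2 (λ x x⁻¹ → (:- x) :* (:- x⁻¹) := x :* x⁻¹) refl x x⁻¹) xx⁻¹≈1

  inverseˡ : ∀ {x} (u : IsUnit x) → proj₁ u * x ≈ 1#
  inverseˡ (x⁻¹ , xx⁻¹≈1) = trans (*-comm x⁻¹ _) xx⁻¹≈1

  IsUnit-inverse : ∀ {x} (u : IsUnit x) → IsUnit (proj₁ u)
  IsUnit-inverse {x} u = x , inverseˡ u

  IsUnit-cancelʳ : ∀ {x y z} → IsUnit z → x * z ≈ y * z → x ≈ y
  IsUnit-cancelʳ {x} {y} {z} (z⁻¹ , zz⁻¹≈1) xz≈yz = begin
    x              ≈⟨ sym (trans (*-congˡ zz⁻¹≈1) (*-identityʳ x)) ⟩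
    x * (z * z⁻¹)  ≈⟨ sym (*-assoc x z z⁻¹) ⟩
    (x * z) * z⁻¹  ≈⟨ *-congʳ xz≈yz ⟩
    (y * z) * z⁻¹  ≈⟨ *-assoc y z z⁻¹ ⟩
    y * (z * z⁻¹)  ≈⟨ trans (*-congˡ zz⁻¹≈1) (*-identityʳ y) ⟩
    y              ∎

  Principal-isIdeal : ∀ x → IsIdeal (Principal x)
  Principal-isIdeal x = record
    { resp  = λ y≈z (k , y≈kx) → k , trans (sym y≈z) y≈kx
    ; zero∈ = 0# , sym (zeroˡ x)
    ; +-cl  = λ (k , y≈kx) (l , z≈lx) → k + l , trans (+-cong y≈kx z≈lx) (sym (distribʳ x k l))
    ; *-cl  = λ t (k , y≈kx) → t * k , trans (*-congˡ y≈kx) (sym (*-assoc t k x)) }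

  module _ {I : K → Set} (I-isIdeal : IsIdeal I) where
    open IsIdeal I-isIdeal

    ideal-neg : ∀ {x} → I x → I (- x)
    ideal-neg {x} Ix = resp (-1*x≈-x x) (*-cl (- 1#) Ix)

    ideal-sub : ∀ {x y} → I x → I y → I (x - y)
    ideal-sub Ix Iy = +-cl Ix (ideal-neg Iy)

    ideal-Σ' : ∀ n {f : Fin n → K} → (∀ j → I (f j)) → I (Σ' n f)
    ideal-Σ' zero    _  = zero∈
    ideal-Σ' (suc n) If = +-cl (If Fin.zero) (ideal-Σ' n (λ j → If (Fin.suc j)))

module ThreeIdeals (R : CommutativeRing 0ℓ 0ℓ) (r : CommutativeRing.Carrier R)
                   (three : RingDefs.ExactlyThreeIdeals R r) where
  open CommutativeRing R renaming (Carrier to K)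
  open RingDefs R
  open UnitsAndIdeals R
  open IntegerCoefficientSolver R
  open import Relation.Binary.Reasoning.Setoid setoid

  J : K → Set
  J = Principal r

  open IsIdeal (Principal-isIdeal r) public
    using () renaming (resp to J-resp; zero∈ to J-0#; +-cl to J-+; *-cl to J-*)

  J-neg : ∀ {x} → J x → J (- x)
  J-neg = ideal-neg (Principal-isIdeal r)

  J-sub : ∀ {x y} → J x → J y → J (x - y)
  J-sub = ideal-sub (Principal-isIdeal r)

  r≉0 : ¬ r ≈ 0#
  r≉0 = proj₁ three

  1∉J : ¬ J 1#
  1∉J = proj₁ (proj₂ three)

  classify : ∀ I → IsIdeal I → (I ≐ ZeroIdeal) ⊎ (I ≐ J) ⊎ (I ≐ WholeIdeal)
  classify = proj₂ (proj₂ three)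

  1≉0 : ¬ 1# ≈ 0#
  1≉0 1≈0 = r≉0 (begin
    r      ≈⟨ sym (*-identityʳ r) ⟩
    r * 1# ≈⟨ *-congˡ 1≈0 ⟩
    r * 0# ≈⟨ zeroʳ r ⟩
    0#     ∎)

  -- ExactlyThreeIdeals quantifies over arbitrary predicates, so classifying
  -- the ideal {x | x ≈ 0# or X} decides X.
  decide : (X : Set) → Dec X
  decide X with classify (λ x → x ≈ 0# ⊎ X) record
    { resp  = λ { y≈z (inj₁ y≈0) → inj₁ (trans (sym y≈z) y≈0) ; _ (inj₂ x) → inj₂ x }
    ; zero∈ = inj₁ refl
    ; +-cl  = λ { (inj₁ y≈0) (inj₁ z≈0) → inj₁ (trans (+-cong y≈0 z≈0) (+-identityʳ 0#))
                ; (inj₂ x) _ → inj₂ x ; _ (inj₂ x) → inj₂ x }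
    ; *-cl  = λ { k (inj₁ y≈0) → inj₁ (trans (*-congˡ y≈0) (zeroʳ k)) ; _ (inj₂ x) → inj₂ x } }
  ... | inj₁ I≐0             = no λ x → 1≉0 (proj₁ (I≐0 1#) (inj₂ x))
  ... | inj₂ (inj₁ I≐J)      = no λ x → 1∉J (proj₁ (I≐J 1#) (inj₂ x))
  ... | inj₂ (inj₂ I≐K) with proj₂ (I≐K 1#) tt
  ...   | inj₁ 1≈0 = no λ _ → 1≉0 1≈0
  ...   | inj₂ x   = yes x

  IsUnit⊎J : ∀ x → IsUnit x ⊎ J x
  IsUnit⊎J x with classify (Principal x) (Principal-isIdeal x)
  ... | inj₁ ⟨x⟩≐0        = inj₂ (J-resp (sym (proj₁ (⟨x⟩≐0 x) x∈⟨x⟩)) J-0#)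
    where x∈⟨x⟩ = 1# , sym (*-identityˡ x)
  ... | inj₂ (inj₁ ⟨x⟩≐J) = inj₂ (proj₁ (⟨x⟩≐J x) (1# , sym (*-identityˡ x)))
  ... | inj₂ (inj₂ ⟨x⟩≐K) = let k , 1≈kx = proj₂ (⟨x⟩≐K 1#) tt in inj₁ (k , trans (*-comm x k) (sym 1≈kx))

  J⇒¬IsUnit : ∀ {x} → J x → ¬ IsUnit x
  J⇒¬IsUnit Jx (y , xy≈1) = 1∉J (J-resp (trans (*-comm y _) xy≈1) (J-* y Jx))

  -- The ideal ⟨r²⟩ is not J: otherwise r ≈ k r², and r would annihilate 1 - k r,
  -- which is a unit because 1 ∉ J.
  r*r≈0 : r * r ≈ 0#
  r*r≈0 with classify (Principal (r * r)) (Principal-isIdeal (r * r))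
  ... | inj₁ ⟨r²⟩≐0        = proj₁ (⟨r²⟩≐0 (r * r)) (1# , sym (*-identityˡ _))
  ... | inj₂ (inj₂ ⟨r²⟩≐K) = let k , 1≈kr² = proj₂ (⟨r²⟩≐K 1#) tt in
                             contradiction (k * r , trans 1≈kr² (sym (*-assoc k r r))) 1∉J
  ... | inj₂ (inj₁ ⟨r²⟩≐J) with proj₂ (⟨r²⟩≐J r) (1# , sym (*-identityˡ r))
  ...   | k , r≈kr² with IsUnit⊎J (1# - k * r)
  ...     | inj₂ (l , 1-kr≈lr) = contradiction (l + k , (begin
            1#                   ≈⟨ solve 2 (λ k r → con (+ 1) := (con (+ 1) :- k :* r) :+ k :* r) refl k r ⟩
            (1# - k * r) + k * r ≈⟨ +-congʳ 1-kr≈lr ⟩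
            l * r + k * r        ≈⟨ sym (distribʳ r l k) ⟩
            (l + k) * r          ∎)) 1∉J
  ...     | inj₁ 1-kr-unit = contradiction (IsUnit-cancelʳ 1-kr-unit (begin
            r * (1# - k * r)     ≈⟨ solve 2 (λ r k → r :* (con (+ 1) :- k :* r) := r :- k :* (r :* r)) refl r k ⟩
            r - k * (r * r)      ≈⟨ +-congˡ (-‿cong (sym r≈kr²)) ⟩
            r - r                ≈⟨ -‿inverseʳ r ⟩
            0#                   ≈⟨ sym (zeroˡ _) ⟩
            0# * (1# - k * r)    ∎)) r≉0

  J⇒r*≈0 : ∀ {x} → J x → r * x ≈ 0#
  J⇒r*≈0 {x} (k , x≈kr) = begin
    r * x       ≈⟨ *-congˡ x≈kr ⟩
    r * (k * r) ≈⟨ solve 2 (λ r k → r :* (k :* r) := k :* (r :* r)) refl r k ⟩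
    k * (r * r) ≈⟨ *-congˡ r*r≈0 ⟩
    k * 0#      ≈⟨ zeroʳ k ⟩
    0#          ∎

  r*≈0⇒J : ∀ {x} → r * x ≈ 0# → J x
  r*≈0⇒J {x} rx≈0 with IsUnit⊎J x
  ... | inj₂ Jx = Jx
  ... | inj₁ x-unit = contradiction (IsUnit-cancelʳ x-unit (trans rx≈0 (sym (zeroˡ x)))) r≉0

module ResidueCounts (R : CommutativeRing 0ℓ 0ℓ) (r : CommutativeRing.Carrier R)
                     (three : RingDefs.ExactlyThreeIdeals R r)
                     (q : ℕ) (q-residues : RingDefs.QuotCard R (RingDefs.Principal R r) q) where
  open CommutativeRing R renaming (Carrier to K)
  open RingDefs R
  open UnitsAndIdeals R
  open ThreeIdeals R r three
  open IntegerCoefficientSolver R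
  open Counting
  open import Algebra.Properties.Ring ring using (+-cancelʳ; x[y-z]≈xy-xz; x∙y⁻¹≈ε⇒x≈y; x≈y⇒x∙y⁻¹≈ε)
  import Data.List.Relation.Unary.All as All

  residueSetoid : Setoid 0ℓ 0ℓ
  residueSetoid = record
    { Carrier       = K
    ; _≈_           = λ x y → J (x - y)
    ; isEquivalence = record
      { refl  = J-resp (sym (-‿inverseʳ _)) J-0#
      ; sym   = λ {x} {y} J[x-y] → J-resp (solve 2 (λ x y → :- (x :- y) := y :- x) refl x y) (J-neg J[x-y])
      ; trans = λ {x} {y} {z} J[x-y] J[y-z] →
                  J-resp (solve 3 (λ x y z → (x :- y) :+ (y :- z) := x :- z) refl x y z) (J-+ J[x-y] J[y-z]) } }

  ≈⇒J-sub : ∀ {x y} → x ≈ y → J (x - y)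
  ≈⇒J-sub x≈y = J-resp (sym (x≈y⇒x∙y⁻¹≈ε x≈y)) J-0#

  residues-size : HasSize residueSetoid (λ _ → ⊤) q
  residues-size = let ys , length≡ , ys! , complete = q-residues in
    record
      { elements = ys ; length≡ = length≡ ; all = All.universal _ ys ; unique = ys! ; complete = λ {x} _ → complete x }

  q-nonZero : ℕ.NonZero q
  q-nonZero = HasSize-nonZero residueSetoid {x = 0#} tt residues-size

  J-size : HasSize setoid J q
  J-size = HasSize-bijection residueSetoid setoid (r *_)
    (λ {x} {y} J[x-y] → x∙y⁻¹≈ε⇒x≈y _ _ (trans (sym (x[y-z]≈xy-xz r x y)) (J⇒r*≈0 J[x-y])))
    (λ {x} {y} rx≈ry → r*≈0⇒J (trans (x[y-z]≈xy-xz r x y) (x≈y⇒x∙y⁻¹≈ε rx≈ry)))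
    (λ {x} _ → x , *-comm r x)
    (λ { (k , y≈kr) → k , tt , trans (*-comm r k) (sym y≈kr) })
    residues-size

  K-size : HasSize setoid (λ _ → ⊤) (q ℕ.* q)
  K-size = HasSize-fibres setoid residueSetoid (λ x → x) ≈⇒J-sub (λ _ → tt) residues-size
    λ {y} _ → HasSize-bijection setoid setoid (_+ y) +-congʳ
      (+-cancelʳ y _ _)
      (λ {x} Jx → tt , J-resp (solve 2 (λ x y → x := (x :+ y) :- y) refl x y) Jx)
      (λ {x} (_ , J[x-y]) → x - y , J[x-y] , solve 2 (λ x y → (x :- y) :+ y := x) refl x y)
      J-size

  units-size : ∃ λ k → HasSize setoid IsUnit k × k ℕ.+ q ≡ q ℕ.* q
  units-size =
    let k , units = HasSize-filter setoid (λ x → decide (IsUnit x)) IsUnit-resp (λ _ → tt) K-size in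
    k , units , HasSize-unique setoid
      (HasSize-resp setoid (λ _ → tt) (λ {x} _ → IsUnit⊎J x)
        (HasSize-∪ setoid units J-size λ x-unit Jy x≈y → J⇒¬IsUnit (J-resp (sym x≈y) Jy) x-unit))
      K-size

module AlternatingForm (R : CommutativeRing 0ℓ 0ℓ) (e : ℕ) where
  open CommutativeRing R renaming (Carrier to K)
  open RingDefs R
  open Vecs e
  open UnitsAndIdeals R
  open IntegerCoefficientSolver R
  open import Algebra.Properties.Ring ring using (-1*x≈-x; -0#≈0#)
  import Data.Fin.Properties as Finₚ
  open import Relation.Binary.Reasoning.Setoid setoid

  Σ'-cong : ∀ n {f g : Fin n → K} → (∀ i → f i ≈ g i) → Σ' n f ≈ Σ' n g
  Σ'-cong zero    _   = refl
  Σ'-cong (suc n) f≈g = +-cong (f≈g Fin.zero) (Σ'-cong n (λ i → f≈g (Fin.suc i)))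

  Σ'-+ : ∀ n (f g : Fin n → K) → Σ' n (λ i → f i + g i) ≈ Σ' n f + Σ' n g
  Σ'-+ zero    f g = sym (+-identityʳ 0#)
  Σ'-+ (suc n) f g = trans (+-congˡ (Σ'-+ n _ _))
    (solve 4 (λ a b c d → (a :+ b) :+ (c :+ d) := (a :+ c) :+ (b :+ d)) refl
      (f Fin.zero) (g Fin.zero) (Σ' n (λ i → f (Fin.suc i))) (Σ' n (λ i → g (Fin.suc i))))

  Σ'-* : ∀ n t (f : Fin n → K) → Σ' n (λ i → t * f i) ≈ t * Σ' n f
  Σ'-* zero    t f = sym (zeroʳ t)
  Σ'-* (suc n) t f = trans (+-congˡ (Σ'-* n t _)) (sym (distribˡ t _ _))

  Σ'-neg : ∀ n (f : Fin n → K) → Σ' n (λ i → - f i) ≈ - Σ' n f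
  Σ'-neg n f = begin
    Σ' n (λ i → - f i)      ≈⟨ Σ'-cong n (λ i → sym (-1*x≈-x (f i))) ⟩
    Σ' n (λ i → - 1# * f i) ≈⟨ Σ'-* n (- 1#) f ⟩
    - 1# * Σ' n f           ≈⟨ -1*x≈-x _ ⟩
    - Σ' n f                ∎

  Σ'-zero : ∀ n {f : Fin n → K} → (∀ i → f i ≈ 0#) → Σ' n f ≈ 0#
  Σ'-zero zero    _    = refl
  Σ'-zero (suc n) f≈0 = trans (+-cong (f≈0 Fin.zero) (Σ'-zero n (λ i → f≈0 (Fin.suc i)))) (+-identityʳ 0#)

  Σ'-single : ∀ n {f : Fin n → K} k → (∀ i → i ≢ k → f i ≈ 0#) → Σ' n f ≈ f k
  Σ'-single (suc n) Fin.zero     f≈0 = trans (+-congˡ (Σ'-zero n (λ i → f≈0 (Fin.suc i) λ ()))) (+-identityʳ _)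
  Σ'-single (suc n) (Fin.suc k) f≈0 =
    trans (+-cong (f≈0 Fin.zero λ ()) (Σ'-single n k λ i i≢k → f≈0 (Fin.suc i) (i≢k ∘ Finₚ.suc-injective)))
          (+-identityˡ _)

  ⟪⟫-cong : ∀ {a a′ c c′} → a ≈v a′ → c ≈v c′ → ⟪ a , c ⟫ ≈ ⟪ a′ , c′ ⟫
  ⟪⟫-cong a≈a′ c≈c′ = Σ'-cong e (λ i → +-cong (*-cong (a≈a′ _) (c≈c′ _)) (-‿cong (*-cong (a≈a′ _) (c≈c′ _))))

  ⟪⟫-congˡ : ∀ {a a′} c → a ≈v a′ → ⟪ a , c ⟫ ≈ ⟪ a′ , c ⟫
  ⟪⟫-congˡ c a≈a′ = ⟪⟫-cong {c = c} {c′ = c} a≈a′ (λ _ → refl)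

  ⟪⟫-congʳ : ∀ a {c c′} → c ≈v c′ → ⟪ a , c ⟫ ≈ ⟪ a , c′ ⟫
  ⟪⟫-congʳ a = ⟪⟫-cong {a = a} {a′ = a} (λ _ → refl)

  ⟪⟫-+ʳ : ∀ a c d → ⟪ a , c +v d ⟫ ≈ ⟪ a , c ⟫ + ⟪ a , d ⟫
  ⟪⟫-+ʳ a c d = trans (Σ'-cong e λ _ → solve 6 (λ x y c₁ c₂ d₁ d₂ →
      x :* (c₁ :+ d₁) :- y :* (c₂ :+ d₂) := (x :* c₁ :- y :* c₂) :+ (x :* d₁ :- y :* d₂)) refl _ _ _ _ _ _)
    (Σ'-+ e _ _)

  ⟪⟫-+ˡ : ∀ a d c → ⟪ a +v d , c ⟫ ≈ ⟪ a , c ⟫ + ⟪ d , c ⟫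
  ⟪⟫-+ˡ a d c = trans (Σ'-cong e λ _ → solve 6 (λ x y a₁ a₂ d₁ d₂ →
      (a₁ :+ d₁) :* x :- (a₂ :+ d₂) :* y := (a₁ :* x :- a₂ :* y) :+ (d₁ :* x :- d₂ :* y)) refl _ _ _ _ _ _)
    (Σ'-+ e _ _)

  ⟪⟫-*ʳ : ∀ a t c → ⟪ a , t ·v c ⟫ ≈ t * ⟪ a , c ⟫
  ⟪⟫-*ʳ a t c = trans (Σ'-cong e λ _ → solve 5 (λ t x y c₁ c₂ →
      x :* (t :* c₁) :- y :* (t :* c₂) := t :* (x :* c₁ :- y :* c₂)) refl _ _ _ _ _)
    (Σ'-* e t _)

  ⟪⟫-*ˡ : ∀ t a c → ⟪ t ·v a , c ⟫ ≈ t * ⟪ a , c ⟫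
  ⟪⟫-*ˡ t a c = trans (Σ'-cong e λ _ → solve 5 (λ t x y a₁ a₂ →
      (t :* a₁) :* x :- (t :* a₂) :* y := t :* (a₁ :* x :- a₂ :* y)) refl _ _ _ _ _)
    (Σ'-* e t _)

  ⟪⟫-antisym : ∀ a c → ⟪ a , c ⟫ ≈ - ⟪ c , a ⟫
  ⟪⟫-antisym a c = trans (Σ'-cong e λ _ → solve 4 (λ a₁ a₂ c₁ c₂ →
      a₁ :* c₂ :- a₂ :* c₁ := :- (c₁ :* a₂ :- c₂ :* a₁)) refl _ _ _ _)
    (Σ'-neg e _)

  ⟪⟫-alternating : ∀ a → ⟪ a , a ⟫ ≈ 0#
  ⟪⟫-alternating a = Σ'-zero e λ _ → solve 2 (λ x y → x :* y :- y :* x := con (+ 0)) refl _ _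

  ⟪⟫≈0-sym : ∀ a c → ⟪ a , c ⟫ ≈ 0# → ⟪ c , a ⟫ ≈ 0#
  ⟪⟫≈0-sym a c ac≈0 = begin
    ⟪ c , a ⟫     ≈⟨ ⟪⟫-antisym c a ⟩
    - ⟪ a , c ⟫   ≈⟨ -‿cong ac≈0 ⟩
    - 0#          ≈⟨ -0#≈0# ⟩
    0#            ∎

  ⟪⟫-translate : ∀ v c t d → ⟪ v , c +v (t ·v d) ⟫ ≈ ⟪ v , c ⟫ + t * ⟪ v , d ⟫
  ⟪⟫-translate v c t d = trans (⟪⟫-+ʳ v c (t ·v d)) (+-congˡ (⟪⟫-*ʳ v t d))

  ⟪⟫-translate-dual : ∀ v c t d → ⟪ v , d ⟫ ≈ 1# → ⟪ v , c +v (t ·v d) ⟫ ≈ ⟪ v , c ⟫ + t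
  ⟪⟫-translate-dual v c t d vd≈1 =
    trans (⟪⟫-translate v c t d) (+-congˡ (trans (*-congˡ vd≈1) (*-identityʳ t)))

  ⟪⟫-translate-orth : ∀ v c t d → ⟪ v , d ⟫ ≈ 0# → ⟪ v , c +v (t ·v d) ⟫ ≈ ⟪ v , c ⟫
  ⟪⟫-translate-orth v c t d vd≈0 =
    trans (⟪⟫-translate v c t d) (trans (+-congˡ (trans (*-congˡ vd≈0) (zeroʳ t))) (+-identityʳ _))

  ⟪⟫-zeroʳ : ∀ v → ⟪ v , 0v ⟫ ≈ 0#
  ⟪⟫-zeroʳ v = Σ'-zero e λ _ → solve 2 (λ x y → x :* con (+ 0) :- y :* con (+ 0) := con (+ 0)) refl _ _

  δ : Fin (e ℕ.+ e) → Vec2e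
  δ j l with l Fin.≟ j
  ... | yes _ = 1#
  ... | no  _ = 0#

  δ-diag : ∀ j → δ j j ≈ 1#
  δ-diag j with j Fin.≟ j
  ... | yes _  = refl
  ... | no j≢j = ⊥-elim (j≢j ≡.refl)

  δ-off : ∀ {j l} → l ≢ j → δ j l ≈ 0#
  δ-off {j} {l} l≢j with l Fin.≟ j
  ... | yes l≡j = ⊥-elim (l≢j l≡j)
  ... | no  _   = refl

  ↑ˡ≢↑ʳ : ∀ (k k′ : Fin e) → k ↑ˡ e ≢ e ↑ʳ k′
  ↑ˡ≢↑ʳ k k′ eq with ≡.trans (≡.sym (Finₚ.splitAt-↑ˡ e k e))
                             (≡.trans (≡.cong (splitAt e) eq) (Finₚ.splitAt-↑ʳ e e k′))
  ... | ()

  private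
    pick : ∀ x y {s t} → s ≈ 1# → t ≈ 0# → x * s - y * t ≈ x
    pick x y s≈1 t≈0 = trans (+-cong (*-congˡ s≈1) (-‿cong (*-congˡ t≈0)))
                             (solve 2 (λ x y → x :* con (+ 1) :- y :* con (+ 0) := x) refl x y)

    vanish : ∀ x y {s t} → s ≈ 0# → t ≈ 0# → x * s - y * t ≈ 0#
    vanish x y s≈0 t≈0 = trans (+-cong (*-congˡ s≈0) (-‿cong (*-congˡ t≈0)))
                               (solve 2 (λ x y → x :* con (+ 0) :- y :* con (+ 0) := con (+ 0)) refl x y)

  ⟪⟫-δ-↑ʳ : ∀ v k → ⟪ v , δ (e ↑ʳ k) ⟫ ≈ v (k ↑ˡ e)
  ⟪⟫-δ-↑ʳ v k = trans
    (Σ'-single e k λ i i≢k → vanish _ _ (δ-off (i≢k ∘ Finₚ.↑ʳ-injective e i k)) (δ-off (↑ˡ≢↑ʳ i k)))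
    (pick _ _ (δ-diag (e ↑ʳ k)) (δ-off (↑ˡ≢↑ʳ k k)))

  ⟪⟫-δ-↑ˡ : ∀ v k → ⟪ v , δ (k ↑ˡ e) ⟫ ≈ - v (e ↑ʳ k)
  ⟪⟫-δ-↑ˡ v k = trans
    (Σ'-single e k λ i i≢k → vanish _ _ (δ-off (↑ˡ≢↑ʳ k i ∘ ≡.sym)) (δ-off (i≢k ∘ Finₚ.↑ˡ-injective e i k)))
    (trans (+-cong (*-congˡ (δ-off (↑ˡ≢↑ʳ k k ∘ ≡.sym))) (-‿cong (*-congˡ (δ-diag (k ↑ˡ e)))))
           (solve 2 (λ x y → x :* con (+ 0) :- y :* con (+ 1) := :- y) refl _ _))

  IsUnit⇒dual : ∀ v i → IsUnit (v i) → ∃ λ z → IsUnit ⟪ v , z ⟫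
  IsUnit⇒dual v i vᵢ-unit with splitAt e i in eq
  ... | inj₁ k rewrite ≡.sym (Finₚ.splitAt⁻¹-↑ˡ eq) =
    δ (e ↑ʳ k) , IsUnit-resp (sym (⟪⟫-δ-↑ʳ v k)) vᵢ-unit
  ... | inj₂ k rewrite ≡.sym (Finₚ.splitAt⁻¹-↑ʳ eq) =
    δ (k ↑ˡ e) , IsUnit-resp (sym (⟪⟫-δ-↑ˡ v k)) (IsUnit-neg vᵢ-unit)

  InV'⇒dual : ∀ {v} → InV' v → ∃ λ x → ⟪ v , x ⟫ ≈ 1#
  InV'⇒dual {v} (i , vᵢ-unit) with IsUnit⇒dual v i vᵢ-unit
  ... | z , s , ⟪v,z⟫s≈1 = s ·v z , trans (⟪⟫-*ʳ v s z) (trans (*-comm s _) ⟪v,z⟫s≈1)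

module Vectors (R : CommutativeRing 0ℓ 0ℓ) (e : ℕ) where
  open CommutativeRing R
  open Counting
  open RingDefs R
  open Vecs e
  open UnitsAndIdeals R
  open AlternatingForm R e
  open IntegerCoefficientSolver R
  open import Algebra.Properties.Ring ring using (+-cancelʳ)
  open import Data.Vec.Functional.Relation.Binary.Equality.Setoid using (≋-setoid)
  open import Relation.Binary.Reasoning.Setoid setoid

  vectorSetoid : Setoid 0ℓ 0ℓ
  vectorSetoid = ≋-setoid setoid (e ℕ.+ e)

  ∼-refl : ∀ {a} → a ∼ a
  ∼-refl = 1# , IsUnit-1# , λ _ → sym (*-identityˡ _)

  ∼-sym : ∀ {a b} → a ∼ b → b ∼ a
  ∼-sym {a} {b} (l , l-unit , b≈la) = proj₁ l-unit , IsUnit-inverse l-unit , λ i → sym (begin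
    l⁻¹ * b i       ≈⟨ *-congˡ (b≈la i) ⟩
    l⁻¹ * (l * a i) ≈⟨ sym (*-assoc _ _ _) ⟩
    (l⁻¹ * l) * a i ≈⟨ *-congʳ (inverseˡ l-unit) ⟩
    1# * a i        ≈⟨ *-identityˡ _ ⟩
    a i             ∎)
    where l⁻¹ = proj₁ l-unit

  ∼-trans : ∀ {a b c} → a ∼ b → b ∼ c → a ∼ c
  ∼-trans (l , l-unit , b≈la) (l′ , l′-unit , c≈l′b) =
    l′ * l , IsUnit-* l′-unit l-unit , λ i → trans (c≈l′b i) (trans (*-congˡ (b≈la i)) (sym (*-assoc _ _ _)))

  ≈v⇒∼ : ∀ {a b} → a ≈v b → a ∼ b
  ≈v⇒∼ a≈b = 1# , IsUnit-1# , λ i → trans (sym (a≈b i)) (sym (*-identityˡ _))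

  pointSetoid : Setoid 0ℓ 0ℓ
  pointSetoid = record
    { Carrier = Vec2e ; _≈_ = _∼_ ; isEquivalence = record { refl = ∼-refl ; sym = ∼-sym ; trans = ∼-trans } }

  InV'-resp-∼ : ∀ {a b} → a ∼ b → InV' a → InV' b
  InV'-resp-∼ (l , l-unit , b≈la) (i , aᵢ-unit) = i , IsUnit-resp (sym (b≈la i)) (IsUnit-* l-unit aᵢ-unit)

  class-size : ∀ {y k} → InV' y → HasSize setoid IsUnit k → HasSize vectorSetoid (_∼ y) k
  class-size {y} (i , yᵢ-unit) = HasSize-bijection setoid vectorSetoid (_·v y)
    (λ l≈l′ _ → *-congʳ l≈l′)
    (λ ly≈l′y → IsUnit-cancelʳ yᵢ-unit (ly≈l′y i))
    (λ {l} l-unit → ∼-sym (l , l-unit , λ _ → refl))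
    (λ c∼y → let l , l-unit , c≈ly = ∼-sym c∼y in l , l-unit , λ j → sym (c≈ly j))

  HasSize-translate : ∀ {P Q n} t d → (∀ {c} → P c → Q (c +v (t ·v d))) → (∀ {c} → Q c → P (c +v ((- t) ·v d))) →
                      HasSize vectorSetoid P n → HasSize vectorSetoid Q n
  HasSize-translate t d P⇒Q Q⇒P = HasSize-bijection vectorSetoid vectorSetoid (λ c → c +v (t ·v d))
    (λ c≈c′ i → +-congʳ (c≈c′ i))
    (λ c+td≈c′+td i → +-cancelʳ _ _ _ (c+td≈c′+td i))
    P⇒Q
    (λ {c} Qc → c +v ((- t) ·v d) , Q⇒P Qc ,
                λ i → solve 3 (λ c t d → (c :+ (:- t) :* d) :+ t :* d := c) refl (c i) t (d i))

  ⟪⟫≈0-resp-∼ˡ : ∀ {a b} c → a ∼ b → ⟪ a , c ⟫ ≈ 0# → ⟪ b , c ⟫ ≈ 0#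
  ⟪⟫≈0-resp-∼ˡ {a} c (l , _ , b≈la) ac≈0 =
    trans (⟪⟫-congˡ c b≈la) (trans (⟪⟫-*ˡ l a c) (trans (*-congˡ ac≈0) (zeroʳ l)))

  ⟪⟫≈0-resp-∼ʳ : ∀ {a b} c → a ∼ b → ⟪ c , a ⟫ ≈ 0# → ⟪ c , b ⟫ ≈ 0#
  ⟪⟫≈0-resp-∼ʳ {a} c (l , _ , b≈la) ca≈0 =
    trans (⟪⟫-congʳ c b≈la) (trans (⟪⟫-*ʳ c l a) (trans (*-congˡ ca≈0) (zeroʳ l)))

  toVertexSetCard : ∀ {P N} → HasSize pointSetoid (λ c → InV' c × P c) N → VertexSetCard P N
  toVertexSetCard X = elements , length≡ , all , unique , λ c c∈V' Pc → complete (c∈V' , Pc)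
    where open HasSize X

module Hyperplane (R : CommutativeRing 0ℓ 0ℓ) (e : ℕ) {I : CommutativeRing.Carrier R → Set}
                  (I-isIdeal : RingDefs.IsIdeal R I) where
  open CommutativeRing R
  open RingDefs R
  open Vecs e
  open Space I
  open UnitsAndIdeals R
  open AlternatingForm R e using (Σ'-cong; Σ'-+; Σ'-*; Σ'-neg)
  open IntegerCoefficientSolver R
  open IsIdeal I-isIdeal
  open import Relation.Binary.Reasoning.Setoid setoid

  module Properties (H : Vec2e → Set) (H-isHyperplane : IsHyperplane H) where

    private
      m = e ℕ.+ e ℕ.∸ 1
      basis = proj₁ H-isHyperplane
      basis⊆T = proj₁ (proj₂ H-isHyperplane)
      spans = proj₂ (proj₂ (proj₂ H-isHyperplane))

    H⊆T : ∀ {x} → H x → InT x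
    H⊆T Hx i = let c , x≈ = proj₁ (spans _) Hx in
      resp (sym (x≈ i)) (ideal-Σ' I-isIdeal m (λ j → *-cl (c j) (basis⊆T j i)))

    H-resp : ∀ {x y} → x ≈v y → H x → H y
    H-resp x≈y Hx = let c , x≈ = proj₁ (spans _) Hx in
      proj₂ (spans _) (c , λ i → trans (sym (x≈y i)) (x≈ i))

    H-scaled-difference : ∀ t {x y} → H x → H y → H (λ i → t * (y i - x i))
    H-scaled-difference t {x} {y} Hx Hy = proj₂ (spans _) ((λ j → t * (cy j - cx j)) , λ i → begin
      t * (y i - x i)                                        ≈⟨ *-congˡ (+-cong (y≈ i) (-‿cong (x≈ i))) ⟩
      t * (Σ' m (λ j → cy j * basis j i) - Σ' m (λ j → cx j * basis j i))
                                                             ≈⟨ *-congˡ (+-congˡ (sym (Σ'-neg m _))) ⟩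
      t * (Σ' m (λ j → cy j * basis j i) + Σ' m (λ j → - (cx j * basis j i)))
                                                             ≈⟨ *-congˡ (sym (Σ'-+ m _ _)) ⟩
      t * Σ' m (λ j → cy j * basis j i + - (cx j * basis j i)) ≈⟨ sym (Σ'-* m t _) ⟩
      Σ' m (λ j → t * (cy j * basis j i + - (cx j * basis j i)))
        ≈⟨ Σ'-cong m (λ j → solve 4 (λ t a b v → t :* (a :* v :+ :- (b :* v)) := (t :* (a :- b)) :* v)
                                    refl t (cy j) (cx j) (basis j i)) ⟩
      Σ' m (λ j → (t * (cy j - cx j)) * basis j i)           ∎)
      where
      cx = proj₁ (proj₁ (spans _) Hx)
      x≈ = proj₂ (proj₁ (spans _) Hx)
      cy = proj₁ (proj₁ (spans _) Hy)
      y≈ = proj₂ (proj₁ (spans _) Hy)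

module CommonNeighbourCount (R : CommutativeRing 0ℓ 0ℓ) (r : CommutativeRing.Carrier R)
                            (three : RingDefs.ExactlyThreeIdeals R r)
                            (q : ℕ) (q-residues : RingDefs.QuotCard R (RingDefs.Principal R r) q) (e : ℕ) where
  open CommutativeRing R
  open RingDefs R
  open Vecs e
  open Space (Principal r)
  open UnitsAndIdeals R
  open ThreeIdeals R r three
  open ResidueCounts R r three q q-residues
  open AlternatingForm R e
  open Vectors R e
  open IntegerCoefficientSolver R
  open Counting
  open Arithmetic using (class-count)
  open import Algebra.Properties.Ring ring using (-0#≈0#)
  open import Algebra.Properties.Group +-group using (x∙y⁻¹≈ε⇒x≈y)
  open import Relation.Binary.Reasoning.Setoid setoid

  InT⊎InV' : ∀ c → InT c ⊎ InV' c
  InT⊎InV' c with decide (InV' c)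
  ... | yes c∈V' = inj₂ c∈V'
  ... | no  c∉V' = inj₁ λ i → [ (λ cᵢ-unit → ⊥-elim (c∉V' (i , cᵢ-unit))) , id ]′ (IsUnit⊎J (c i))

  InV'⇒¬InT : ∀ {c} → InV' c → ¬ InT c
  InV'⇒¬InT (i , cᵢ-unit) c∈T = J⇒¬IsUnit (c∈T i) cᵢ-unit

  InT⇒J⟪⟫ : ∀ v {c} → InT c → J ⟪ v , c ⟫
  InT⇒J⟪⟫ v {c} c∈T = r*≈0⇒J (begin
    r * ⟪ v , c ⟫  ≈⟨ sym (⟪⟫-*ʳ v r c) ⟩
    ⟪ v , r ·v c ⟫ ≈⟨ ⟪⟫-congʳ v (λ i → J⇒r*≈0 (c∈T i)) ⟩
    ⟪ v , 0v ⟫     ≈⟨ ⟪⟫-zeroʳ v ⟩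
    0#             ∎)

  ¬AdjX⇒⟪⟫≈0 : ∀ x y → ¬ AdjX x y → ⟪ x , y ⟫ ≈ 0#
  ¬AdjX⇒⟪⟫≈0 x y = decidable-stable (decide _)

  vectors-size : HasSize vectorSetoid (λ c → ∀ i → ⊤) ((q ℕ.* q) ℕ.^ (e ℕ.+ e))
  vectors-size = HasSize-Π setoid (e ℕ.+ e) K-size

  T-size : HasSize vectorSetoid InT (q ℕ.^ (e ℕ.+ e))
  T-size = HasSize-Π setoid (e ℕ.+ e) J-size

  subset-size : ∀ {P} → (∀ {c c′} → c ≈v c′ → P c → P c′) → ∃ (HasSize vectorSetoid P)
  subset-size P-resp = HasSize-filter vectorSetoid (λ c → decide _) P-resp (λ _ _ → tt) vectors-size

  module OrthogonalCounts (a w : Vec2e) (a∈V' : InV' a) (w-indep : ∀ μ → ¬ InT (w +v (μ ·v a))) where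

    x₁ : Vec2e
    x₁ = proj₁ (InV'⇒dual a∈V')

    ⟪a,x₁⟫≈1 : ⟪ a , x₁ ⟫ ≈ 1#
    ⟪a,x₁⟫≈1 = proj₂ (InV'⇒dual a∈V')

    -- y₁ is z minus its x₁-component, where z is dual to w - ⟪w,x₁⟫ a; the
    -- latter lies in V' because w is independent of a modulo J.
    y₁-dual : ∃ λ y₁ → ⟪ a , y₁ ⟫ ≈ 0# × ⟪ w , y₁ ⟫ ≈ 1#
    y₁-dual = z +v ((- ⟪ a , z ⟫) ·v x₁) , ⟪a,y₁⟫≈0 , ⟪w,y₁⟫≈1
      where
      μ = ⟪ w , x₁ ⟫
      w′∈V' : InV' (w +v ((- μ) ·v a))
      w′∈V' = [ (λ w′∈T → ⊥-elim (w-indep (- μ) w′∈T)) , id ]′ (InT⊎InV' _)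
      z = proj₁ (InV'⇒dual w′∈V')
      ⟪a,y₁⟫≈0 = trans (⟪⟫-translate-dual a z _ x₁ ⟪a,x₁⟫≈1) (-‿inverseʳ _)
      ⟪w,y₁⟫≈1 = begin
        ⟪ w , z +v ((- ⟪ a , z ⟫) ·v x₁) ⟫    ≈⟨ ⟪⟫-translate w z _ x₁ ⟩
        ⟪ w , z ⟫ + - ⟪ a , z ⟫ * μ           ≈⟨ solve 3 (λ x y μ → x :+ (:- y) :* μ := x :+ (:- μ) :* y) refl _ _ μ ⟩
        ⟪ w , z ⟫ + - μ * ⟪ a , z ⟫           ≈⟨ +-congˡ (sym (⟪⟫-*ˡ (- μ) a z)) ⟩
        ⟪ w , z ⟫ + ⟪ (- μ) ·v a , z ⟫        ≈⟨ sym (⟪⟫-+ˡ w ((- μ) ·v a) z) ⟩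
        ⟪ w +v ((- μ) ·v a) , z ⟫             ≈⟨ proj₂ (InV'⇒dual w′∈V') ⟩
        1#                                    ∎

    y₁ : Vec2e
    y₁ = proj₁ y₁-dual

    ⟪a,y₁⟫≈0 : ⟪ a , y₁ ⟫ ≈ 0#
    ⟪a,y₁⟫≈0 = proj₁ (proj₂ y₁-dual)

    ⟪w,y₁⟫≈1 : ⟪ w , y₁ ⟫ ≈ 1#
    ⟪w,y₁⟫≈1 = proj₂ (proj₂ y₁-dual)

    ⊥a : Vec2e → Set
    ⊥a c = ⟪ a , c ⟫ ≈ 0#

    ⊥a⊥w : Vec2e → Set
    ⊥a⊥w c = ⊥a c × J ⟪ w , c ⟫

    ⊥a∩T : Vec2e → Set
    ⊥a∩T c = InT c × ⊥a c

    ⊥a⊥w∩V' : Vec2e → Set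
    ⊥a⊥w∩V' c = InV' c × ⊥a⊥w c

    ⊥a-resp : ∀ {c c′} → c ≈v c′ → ⊥a c → ⊥a c′
    ⊥a-resp c≈c′ = trans (⟪⟫-congʳ a (λ i → sym (c≈c′ i)))

    ⊥a⊥w-resp : ∀ {c c′} → c ≈v c′ → ⊥a⊥w c → ⊥a⊥w c′
    ⊥a⊥w-resp c≈c′ (ac≈0 , J⟪w,c⟫) = ⊥a-resp c≈c′ ac≈0 , J-resp (⟪⟫-congʳ w c≈c′) J⟪w,c⟫

    ⊥a∩T-resp : ∀ {c c′} → c ≈v c′ → ⊥a∩T c → ⊥a∩T c′
    ⊥a∩T-resp c≈c′ (c∈T , ac≈0) = (λ i → J-resp (c≈c′ i) (c∈T i)) , ⊥a-resp c≈c′ ac≈0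

    ⊥a⊥w∩V'-resp-∼ : ∀ {c c′} → c ∼ c′ → ⊥a⊥w∩V' c → ⊥a⊥w∩V' c′
    ⊥a⊥w∩V'-resp-∼ {c} c∼c′@(l , _ , c′≈lc) (c∈V' , ac≈0 , J⟪w,c⟫) =
      InV'-resp-∼ c∼c′ c∈V' , ⟪⟫≈0-resp-∼ʳ a c∼c′ ac≈0 ,
      J-resp (sym (trans (⟪⟫-congʳ w c′≈lc) (⟪⟫-*ʳ w l c))) (J-* l J⟪w,c⟫)

    -- In the next three counts, translation by t x₁ (resp. t y₁) carries the fibre over 0
    -- of ⟪ a ,_⟫ (resp. of ⟪ w ,_⟫ modulo J) onto the fibre over t.
    ⊥a-size : ∀ {n₀} → HasSize vectorSetoid ⊥a n₀ → (q ℕ.* q) ℕ.* n₀ ≡ (q ℕ.* q) ℕ.^ (e ℕ.+ e)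
    ⊥a-size ⊥a-n₀ = HasSize-unique vectorSetoid
      (HasSize-fibres vectorSetoid setoid ⟪ a ,_⟫ (⟪⟫-congʳ a) (λ _ → tt) K-size λ {t} _ →
        HasSize-translate t x₁
          (λ {c} ac≈0 → (λ _ → tt) ,
            trans (⟪⟫-translate-dual a c t x₁ ⟪a,x₁⟫≈1) (trans (+-congʳ ac≈0) (+-identityˡ t)))
          (λ {c} (_ , ac≈t) → trans (⟪⟫-translate-dual a c (- t) x₁ ⟪a,x₁⟫≈1) (trans (+-congʳ ac≈t) (-‿inverseʳ t)))
          ⊥a-n₀)
      vectors-size

    ⊥a⊥w-size : ∀ {n₀ n₁} → HasSize vectorSetoid ⊥a n₀ → HasSize vectorSetoid ⊥a⊥w n₁ → q ℕ.* n₁ ≡ n₀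
    ⊥a⊥w-size ⊥a-n₀ ⊥a⊥w-n₁ = HasSize-unique vectorSetoid
      (HasSize-fibres vectorSetoid residueSetoid ⟪ w ,_⟫ (≈⇒J-sub ∘ ⟪⟫-congʳ w) (λ _ → tt) residues-size λ {t} _ →
        HasSize-translate t y₁
          (λ {c} (ac≈0 , J⟪w,c⟫) → trans (⟪⟫-translate-orth a c t y₁ ⟪a,y₁⟫≈0) ac≈0 ,
            J-resp (trans (solve 2 (λ x t → x := (x :+ t) :- t) refl _ t)
                          (+-congʳ (sym (⟪⟫-translate-dual w c t y₁ ⟪w,y₁⟫≈1))))
                   J⟪w,c⟫)
          (λ {c} (ac≈0 , J[⟪w,c⟫-t]) → trans (⟪⟫-translate-orth a c (- t) y₁ ⟪a,y₁⟫≈0) ac≈0 ,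
            J-resp (sym (⟪⟫-translate-dual w c (- t) y₁ ⟪w,y₁⟫≈1)) J[⟪w,c⟫-t])
          ⊥a⊥w-n₁)
      ⊥a-n₀

    ⊥a∩T-size : ∀ {n₂} → HasSize vectorSetoid ⊥a∩T n₂ → q ℕ.* n₂ ≡ q ℕ.^ (e ℕ.+ e)
    ⊥a∩T-size ⊥a∩T-n₂ = HasSize-unique vectorSetoid
      (HasSize-fibres vectorSetoid setoid ⟪ a ,_⟫ (⟪⟫-congʳ a) (InT⇒J⟪⟫ a) J-size λ {t} Jt →
        HasSize-translate t x₁
          (λ {c} (c∈T , ac≈0) → InT-translate c∈T Jt ,
            trans (⟪⟫-translate-dual a c t x₁ ⟪a,x₁⟫≈1) (trans (+-congʳ ac≈0) (+-identityˡ t)))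
          (λ {c} (c∈T , ac≈t) → InT-translate c∈T (J-neg Jt) ,
            trans (⟪⟫-translate-dual a c (- t) x₁ ⟪a,x₁⟫≈1) (trans (+-congʳ ac≈t) (-‿inverseʳ t)))
          ⊥a∩T-n₂)
      T-size
      where
      InT-translate : ∀ {c t} → InT c → J t → InT (c +v (t ·v x₁))
      InT-translate {t = t} c∈T Jt i = J-+ (c∈T i) (J-resp (*-comm (x₁ i) t) (J-* (x₁ i) Jt))

    ⊥a⊥w-partition : ∀ {n₁ n₂ n₃} → HasSize vectorSetoid ⊥a⊥w n₁ → HasSize vectorSetoid ⊥a∩T n₂ →
                     HasSize vectorSetoid ⊥a⊥w∩V' n₃ → n₃ ℕ.+ n₂ ≡ n₁
    ⊥a⊥w-partition ⊥a⊥w-n₁ ⊥a∩T-n₂ ⊥a⊥w∩V'-n₃ = HasSize-unique vectorSetoid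
      (HasSize-resp vectorSetoid
        [ proj₂ , (λ (c∈T , ac≈0) → ac≈0 , InT⇒J⟪⟫ w c∈T) ]′
        (λ {c} c∈⊥ → [ (λ c∈T → inj₂ (c∈T , proj₁ c∈⊥)) , (λ c∈V' → inj₁ (c∈V' , c∈⊥)) ]′ (InT⊎InV' c))
        (HasSize-∪ vectorSetoid ⊥a⊥w∩V'-n₃ ⊥a∩T-n₂ λ (c∈V' , _) (c′∈T , _) c≈c′ →
          InV'⇒¬InT c∈V' (λ i → J-resp (sym (c≈c′ i)) (c′∈T i))))
      ⊥a⊥w-n₁

    ⊥a⊥w∩V'-classes : ∀ {n₃ N k} → HasSize vectorSetoid ⊥a⊥w∩V' n₃ → HasSize pointSetoid ⊥a⊥w∩V' N →
                      HasSize setoid IsUnit k → N ℕ.* k ≡ n₃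
    ⊥a⊥w∩V'-classes ⊥a⊥w∩V'-n₃ points units = HasSize-unique vectorSetoid
      (HasSize-fibres vectorSetoid pointSetoid id ≈v⇒∼ id points λ {y} y∈ →
        HasSize-resp vectorSetoid (λ c∼y → ⊥a⊥w∩V'-resp-∼ (∼-sym c∼y) y∈ , c∼y) proj₂ (class-size (proj₁ y∈) units))
      ⊥a⊥w∩V'-n₃

    ⊥a⊥w∩V'-points : ∀ m → e ℕ.+ e ≡ 2 ℕ.+ m →
                     ∃ λ N → HasSize pointSetoid ⊥a⊥w∩V' N × N ℕ.* (q ℕ.∸ 1) ≡ (q ℕ.^ m ℕ.∸ 1) ℕ.* q ℕ.^ m
    ⊥a⊥w∩V'-points m e+e≡2+m =
      let n₀ , ⊥a-n₀       = subset-size ⊥a-resp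
          n₁ , ⊥a⊥w-n₁     = subset-size ⊥a⊥w-resp
          n₂ , ⊥a∩T-n₂     = subset-size ⊥a∩T-resp
          n₃ , ⊥a⊥w∩V'-n₃  = subset-size (λ c≈c′ → ⊥a⊥w∩V'-resp-∼ (≈v⇒∼ c≈c′))
          N , points       = HasSize-image vectorSetoid pointSetoid (λ c c′ → decide (c ∼ c′)) id ≈v⇒∼ id
                               (λ {c} c∈ → c , c∈ , ∼-refl) ⊥a⊥w∩V'-n₃
          k , units , k+q≡q² = units-size
      in N , points , class-count q m {n₀} {n₁} {n₂} {n₃} {N} {k} {{q-nonZero}} k+q≡q²
           (≡.subst (λ n → (q ℕ.* q) ℕ.* n₀ ≡ (q ℕ.* q) ℕ.^ n) e+e≡2+m (⊥a-size ⊥a-n₀))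
           (⊥a⊥w-size ⊥a-n₀ ⊥a⊥w-n₁)
           (≡.subst (λ n → q ℕ.* n₂ ≡ q ℕ.^ n) e+e≡2+m (⊥a∩T-size ⊥a∩T-n₂))
           (⊥a⊥w-partition ⊥a⊥w-n₁ ⊥a∩T-n₂ ⊥a⊥w∩V'-n₃)
           (⊥a⊥w∩V'-classes ⊥a⊥w∩V'-n₃ points units)

  module CommonNeighbours (H : Vec2e → Set) (H-isHyperplane : IsHyperplane H) (u : Vec2e) (ru∉H : ¬ H (r· r u))
                          (a b : Vec2e) (a∈V' : InV' a) (b∈V' : InV' b)
                          (a∈C : InClass H u a) (b∈C : InClass H u b) where
    open Hyperplane.Properties R e (Principal-isIdeal r) H H-isHyperplane

    private
      h    = proj₁ a∈C
      h′   = proj₁ b∈C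
      h∈H  = proj₁ (proj₂ a∈C)
      h′∈H = proj₁ (proj₂ b∈C)

    a′ b′ : Vec2e
    a′ = u +v h
    b′ = u +v h′

    a′∼a : a′ ∼ a
    a′∼a = proj₂ (proj₂ a∈C)

    b′∼b : b′ ∼ b
    b′∼b = proj₂ (proj₂ b∈C)

    a′∈V' : InV' a′
    a′∈V' = InV'-resp-∼ (∼-sym a′∼a) a∈V'

    J[h′-h] : ∀ i → J (h′ i - h i)
    J[h′-h] i = J-sub (H⊆T h′∈H i) (H⊆T h∈H i)

    w : Vec2e
    w i = proj₁ (J[h′-h] i)

    h′-h≈rw : ∀ i → h′ i - h i ≈ r * w i
    h′-h≈rw i = trans (proj₂ (J[h′-h] i)) (*-comm _ r)

    ⟪b′,c⟫≈⟪a′,c⟫+r⟪w,c⟫ : ∀ c → ⟪ b′ , c ⟫ ≈ ⟪ a′ , c ⟫ + r * ⟪ w , c ⟫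
    ⟪b′,c⟫≈⟪a′,c⟫+r⟪w,c⟫ c = begin
      ⟪ b′ , c ⟫               ≈⟨ ⟪⟫-congˡ c b′≈a′+rw ⟩
      ⟪ a′ +v (r ·v w) , c ⟫   ≈⟨ ⟪⟫-+ˡ a′ (r ·v w) c ⟩
      ⟪ a′ , c ⟫ + ⟪ r ·v w , c ⟫ ≈⟨ +-congˡ (⟪⟫-*ˡ r w c) ⟩
      ⟪ a′ , c ⟫ + r * ⟪ w , c ⟫ ∎
      where
      b′≈a′+rw : b′ ≈v (a′ +v (r ·v w))
      b′≈a′+rw i = trans (solve 3 (λ u h h′ → u :+ h′ := (u :+ h) :+ (h′ :- h)) refl (u i) (h i) (h′ i))
                         (+-congˡ (h′-h≈rw i))

    h′-h≈-μru : ∀ μ → InT (w +v (μ ·v a′)) → ∀ i → h′ i - h i ≈ - (μ * (r * u i))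
    h′-h≈-μru μ w+μa′∈T i = begin
      h′ i - h i                               ≈⟨ h′-h≈rw i ⟩
      r * w i                                  ≈⟨ solve 4 (λ r w μ x → r :* w := r :* (w :+ μ :* x) :- μ :* (r :* x))
                                                          refl r (w i) μ (a′ i) ⟩
      r * (w i + μ * a′ i) - μ * (r * a′ i)    ≈⟨ +-cong (J⇒r*≈0 (w+μa′∈T i)) (-‿cong (*-congˡ ra′≈ru)) ⟩
      0# - μ * (r * u i)                       ≈⟨ +-identityˡ _ ⟩
      - (μ * (r * u i))                        ∎
      where
      ra′≈ru : r * a′ i ≈ r * u i
      ra′≈ru = trans (distribˡ r (u i) (h i)) (trans (+-congˡ (J⇒r*≈0 (H⊆T h∈H i))) (+-identityʳ _))

    -- By h′-h≈-μru, μ ∈ J would force [a] = [b], and a unit μ would put r u into H.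
    w-indep : ¬ a ∼ b → ∀ μ → ¬ InT (w +v (μ ·v a′))
    w-indep a≁b μ w+μa′∈T with IsUnit⊎J μ
    ... | inj₂ Jμ = a≁b (∼-trans (∼-sym a′∼a) (∼-trans (≈v⇒∼ a′≈b′) b′∼b))
      where
      a′≈b′ : a′ ≈v b′
      a′≈b′ i = sym (+-congˡ (x∙y⁻¹≈ε⇒x≈y _ _ (begin
        h′ i - h i            ≈⟨ h′-h≈-μru μ w+μa′∈T i ⟩
        - (μ * (r * u i))     ≈⟨ -‿cong (solve 3 (λ μ r u → μ :* (r :* u) := (r :* μ) :* u) refl μ r (u i)) ⟩
        - ((r * μ) * u i)     ≈⟨ -‿cong (trans (*-congʳ (J⇒r*≈0 Jμ)) (zeroˡ _)) ⟩
        - 0#                  ≈⟨ -0#≈0# ⟩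
        0#                    ∎)))
    ... | inj₁ μ-unit = ru∉H (H-resp ru≈ (H-scaled-difference (- μ⁻¹) h∈H h′∈H))
      where
      μ⁻¹ = proj₁ μ-unit
      ru≈ : ∀ i → - μ⁻¹ * (h′ i - h i) ≈ r * u i
      ru≈ i = begin
        - μ⁻¹ * (h′ i - h i)        ≈⟨ *-congˡ (h′-h≈-μru μ w+μa′∈T i) ⟩
        - μ⁻¹ * - (μ * (r * u i))   ≈⟨ solve 3 (λ m n x → :- m :* (:- (n :* x)) := (n :* m) :* x)
                                               refl μ⁻¹ μ (r * u i) ⟩
        (μ * μ⁻¹) * (r * u i)       ≈⟨ trans (*-congʳ (proj₂ μ-unit)) (*-identityˡ _) ⟩
        r * u i                     ∎

    ⊥a′⊥w⇒⊥a⊥b : ∀ c → ⟪ a′ , c ⟫ ≈ 0# × J ⟪ w , c ⟫ → ⟪ a , c ⟫ ≈ 0# × ⟪ b , c ⟫ ≈ 0#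
    ⊥a′⊥w⇒⊥a⊥b c (a′c≈0 , J⟪w,c⟫) = ⟪⟫≈0-resp-∼ˡ c a′∼a a′c≈0 , ⟪⟫≈0-resp-∼ˡ c b′∼b (begin
      ⟪ b′ , c ⟫                 ≈⟨ ⟪b′,c⟫≈⟪a′,c⟫+r⟪w,c⟫ c ⟩
      ⟪ a′ , c ⟫ + r * ⟪ w , c ⟫ ≈⟨ +-cong a′c≈0 (J⇒r*≈0 J⟪w,c⟫) ⟩
      0# + 0#                    ≈⟨ +-identityˡ 0# ⟩
      0#                         ∎)

    ⊥a⊥b⇒⊥a′⊥w : ∀ c → ⟪ a , c ⟫ ≈ 0# × ⟪ b , c ⟫ ≈ 0# → ⟪ a′ , c ⟫ ≈ 0# × J ⟪ w , c ⟫
    ⊥a⊥b⇒⊥a′⊥w c (ac≈0 , bc≈0) = a′c≈0 , r*≈0⇒J (begin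
      r * ⟪ w , c ⟫                ≈⟨ sym (+-identityˡ _) ⟩
      0# + r * ⟪ w , c ⟫           ≈⟨ +-congʳ (sym a′c≈0) ⟩
      ⟪ a′ , c ⟫ + r * ⟪ w , c ⟫   ≈⟨ sym (⟪b′,c⟫≈⟪a′,c⟫+r⟪w,c⟫ c) ⟩
      ⟪ b′ , c ⟫                   ≈⟨ ⟪⟫≈0-resp-∼ˡ c (∼-sym b′∼b) bc≈0 ⟩
      0#                           ∎)
      where a′c≈0 = ⟪⟫≈0-resp-∼ˡ c (∼-sym a′∼a) ac≈0

    common⇒⊥a′⊥w : ∀ {c} → InV' c × CommonNbrs a b c → InV' c × ⟪ a′ , c ⟫ ≈ 0# × J ⟪ w , c ⟫
    common⇒⊥a′⊥w {c} (c∈V' , (_ , ¬ac≉0) , (_ , ¬bc≉0)) =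
      c∈V' , ⊥a⊥b⇒⊥a′⊥w c (¬AdjX⇒⟪⟫≈0 a c ¬ac≉0 , ¬AdjX⇒⟪⟫≈0 b c ¬bc≉0)

    common-neighbours-of-X-adjacent : ¬ a ∼ b → AdjX a b → ∀ m → e ℕ.+ e ≡ 2 ℕ.+ m →
      ∃ λ N → VertexSetCard (CommonNbrs a b) N × N ℕ.* (q ℕ.∸ 1) ≡ (q ℕ.^ m ℕ.∸ 1) ℕ.* q ℕ.^ m
    common-neighbours-of-X-adjacent a≁b ab≉0 m e+e≡2+m =
      let N , points , count = ⊥a⊥w∩V'-points m e+e≡2+m in
      N , toVertexSetCard (HasSize-resp pointSetoid ⊥⇒common common⇒⊥a′⊥w points) , count
      where
      open OrthogonalCounts a′ w a′∈V' (w-indep a≁b)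
      ⊥⇒common : ∀ {c} → ⊥a⊥w∩V' c → InV' c × CommonNbrs a b c
      ⊥⇒common {c} (c∈V' , c∈⊥) = let ac≈0 , bc≈0 = ⊥a′⊥w⇒⊥a⊥b c c∈⊥ in
        c∈V' ,
        ((λ a∼c → ab≉0 (⟪⟫≈0-sym b a (⟪⟫≈0-resp-∼ʳ b (∼-sym a∼c) bc≈0))) , λ ac≉0 → ac≉0 ac≈0) ,
        ((λ b∼c → ab≉0 (⟪⟫≈0-resp-∼ʳ a (∼-sym b∼c) ac≈0)) , λ bc≉0 → bc≉0 bc≈0)

    CommonNbrs-resp-∼ : ∀ {c c′} → c ∼ c′ → InV' c × CommonNbrs a b c → InV' c′ × CommonNbrs a b c′
    CommonNbrs-resp-∼ {c} {c′} c∼c′ (c∈V' , (a≁c , ¬ac≉0) , (b≁c , ¬bc≉0)) =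
      InV'-resp-∼ c∼c′ c∈V' ,
      ((λ a∼c′ → a≁c (∼-trans a∼c′ (∼-sym c∼c′))) , λ ac′≉0 → ac′≉0 (⟪⟫≈0-resp-∼ʳ a c∼c′ (¬AdjX⇒⟪⟫≈0 a c ¬ac≉0))) ,
      ((λ b∼c′ → b≁c (∼-trans b∼c′ (∼-sym c∼c′))) , λ bc′≉0 → bc′≉0 (⟪⟫≈0-resp-∼ʳ b c∼c′ (¬AdjX⇒⟪⟫≈0 b c ¬bc≉0)))

    -- Here [a] and [b] are themselves orthogonal to both, hence the correction by 2.
    common-neighbours-of-X̄-adjacent : AdjXbar a b → ∀ m → e ℕ.+ e ≡ 2 ℕ.+ m →
      ∃ λ N → VertexSetCard (CommonNbrs a b) N × (N ℕ.+ 2) ℕ.* (q ℕ.∸ 1) ≡ (q ℕ.^ m ℕ.∸ 1) ℕ.* q ℕ.^ m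
    common-neighbours-of-X̄-adjacent (a≁b , ¬ab≉0) m e+e≡2+m =
      let N′ , points , count = ⊥a⊥w∩V'-points m e+e≡2+m
          N , common = HasSize-filter pointSetoid (λ c → decide _) CommonNbrs-resp-∼ common⇒⊥a′⊥w points
          a-b-common = HasSize-∪ pointSetoid common
            (HasSize-∪ pointSetoid (HasSize-singleton pointSetoid a ∼-refl id)
                                   (HasSize-singleton pointSetoid b ∼-refl id)
              λ c∼a c′∼b c∼c′ → a≁b (∼-trans (∼-sym c∼a) (∼-trans c∼c′ c′∼b)))
            λ { (_ , (a≁c , _) , _) (inj₁ c′∼a) c∼c′ → a≁c (∼-sym (∼-trans c∼c′ c′∼a))
              ; (_ , _ , (b≁c , _)) (inj₂ c′∼b) c∼c′ → b≁c (∼-sym (∼-trans c∼c′ c′∼b)) }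
          N+2≡N′ = HasSize-unique pointSetoid
                     (HasSize-resp pointSetoid [common,a,b]⇒⊥ ⊥⇒[common,a,b] a-b-common) points
      in N , toVertexSetCard common , ≡.trans (≡.cong (ℕ._* (q ℕ.∸ 1)) N+2≡N′) count
      where
      open OrthogonalCounts a′ w a′∈V' (w-indep a≁b)
      ab≈0 = ¬AdjX⇒⟪⟫≈0 a b ¬ab≉0
      [common,a,b]⇒⊥ : ∀ {c} → (InV' c × CommonNbrs a b c) ⊎ (c ∼ a ⊎ c ∼ b) → ⊥a⊥w∩V' c
      [common,a,b]⇒⊥ (inj₁ c∈) = common⇒⊥a′⊥w c∈
      [common,a,b]⇒⊥ {c} (inj₂ (inj₁ c∼a)) = InV'-resp-∼ (∼-sym c∼a) a∈V' ,
        ⊥a⊥b⇒⊥a′⊥w c (⟪⟫≈0-resp-∼ʳ a (∼-sym c∼a) (⟪⟫-alternating a) , ⟪⟫≈0-resp-∼ʳ b (∼-sym c∼a) (⟪⟫≈0-sym a b ab≈0))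
      [common,a,b]⇒⊥ {c} (inj₂ (inj₂ c∼b)) = InV'-resp-∼ (∼-sym c∼b) b∈V' ,
        ⊥a⊥b⇒⊥a′⊥w c (⟪⟫≈0-resp-∼ʳ a (∼-sym c∼b) ab≈0 , ⟪⟫≈0-resp-∼ʳ b (∼-sym c∼b) (⟪⟫-alternating b))
      ⊥⇒[common,a,b] : ∀ {c} → ⊥a⊥w∩V' c → (InV' c × CommonNbrs a b c) ⊎ (c ∼ a ⊎ c ∼ b)
      ⊥⇒[common,a,b] {c} (c∈V' , c∈⊥) with decide (c ∼ a) | decide (c ∼ b)
      ... | yes c∼a | _       = inj₂ (inj₁ c∼a)
      ... | no _    | yes c∼b = inj₂ (inj₂ c∼b)
      ... | no c≁a  | no c≁b  = let ac≈0 , bc≈0 = ⊥a′⊥w⇒⊥a⊥b c c∈⊥ in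
        inj₁ (c∈V' , ((c≁a ∘ ∼-sym) , λ ac≉0 → ac≉0 ac≈0) , ((c≁b ∘ ∼-sym) , λ bc≉0 → bc≉0 bc≈0))

open import Data.Nat using (_≤_; _+_; _*_; _∸_; _^_)
open import Data.Nat.Properties using (≤-trans; m≤m+n; m+[n∸m]≡n)

proposition3p8 : (R : CommutativeRing 0ℓ 0ℓ) (e : ℕ) → 2 ≤ e →
    (r : CommutativeRing.Carrier R) →
    let open RingDefs R
        open Vecs e
        open Space (Principal r)
        M = λ (q' : ℕ) → (q' ^ (e + e ∸ 2) ∸ 1) * q' ^ (e + e ∸ 2)
    in IsFinite → ExactlyThreeIdeals r →
       (q : ℕ) → IsPrimePower q → QuotCard (Principal r) q →
       (H : Vec2e → Set) → IsHyperplane H →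
       (u : Vec2e) → InV' u → ¬ H (r· r u) →
       (a b : Vec2e) → InV' a → InV' b → InClass H u a → InClass H u b →
       ((¬ (a ∼ b) → AdjX a b →
           ∃ λ N → VertexSetCard (CommonNbrs a b) N × N * (q ∸ 1) ≡ M q) ×
        (AdjXbar a b →
           ∃ λ N → VertexSetCard (CommonNbrs a b) N × (N + 2) * (q ∸ 1) ≡ M q))
proposition3p8 R e 2≤e r _ three q _ q-residues H H-isHyperplane u _ ru∉H a b a∈V' b∈V' a∈C b∈C =
  (λ a≁b ab≉0 → common-neighbours-of-X-adjacent a≁b ab≉0 (e + e ∸ 2) e+e≡2+m) ,
  (λ a~b → common-neighbours-of-X̄-adjacent a~b (e + e ∸ 2) e+e≡2+m)
  where
  open CommonNeighbourCount.CommonNeighbours R r three q q-residues e H H-isHyperplane u ru∉H a b a∈V' b∈V' a∈C b∈C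
  e+e≡2+m : e + e ≡ 2 + (e + e ∸ 2)
  e+e≡2+m = ≡.sym (m+[n∸m]≡n (≤-trans 2≤e (m≤m+n e e)))
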